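{- Let $\xi$ be an address, $n\in\mathbb N$, and let $\mathbb L_n=\{\mathfrak D^{\langle a_1,\dots,a_n\rangle}_\xi\mid a_1,\dots,a_n\in\mathbb N\}$ be the set of designs on base $\vdash\xi$ representing lists of natural numbers of length $n$. Then $\mathbb L_n$ is principal: its elements are $\maltese$-free and $|(\mathbb L_n)^{\perp\perp}|=(\mathbb L_n)^{\maltese}$.
   Context: Ludics (Girard). An address is a finite sequence of natural numbers; $\xi.i$ denotes extension. An action is $(+,\xi,I)$, $(-,\xi,I)$ ($I$ finite set of naturals, the ramification) or the daimon $\maltese$ (positive). An action with address $\xi.i$ is justified by an action of opposite polarity with address $\xi$ whose ramification contains $i$. A base $\Gamma\vdash\Delta$: $\Gamma$ at most one address, $\Delta$ finite, addresses pairwise prefix-disjoint; positive if $\Gamma=\emptyset$. A chronicle on a base is a nonempty finite alternating sequence of actions, each proper action being initial (first negative action with address in $\Gamma$, or positive action with address in $\Delta$) or justified by an earlier action, non-initial negative actions being justified by the immediately preceding action; distinct addresses; $\maltese$ only last. Chronicles are coherent if one extends the other or they first differ on negative actions, and if those have distinct addresses all later actions have pairwise distinct addresses. A design is a prefix-closed, pairwise coherent set of chronicles on a base whose maximal chronicles end positively and which, for positive base, is nonempty with a common first positive action. $\maltese$-free: no chronicle contains $\maltese$. Interaction of a closed cut-net: starting from the positive design, if its first action is $\maltese$ the result is $\{\maltese\}$; if $(+,\sigma,I)$, the design cut on $\sigma$ must have a chronicle starting $(-,\sigma,I)$ (else failure) and interaction continues on the subdesigns above these actions. $\mathfrak D\perp\mathfrak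 R$ iff the result is $\{\maltese\}$; $E^\perp$ = designs orthogonal to all of $E$. Incarnation: $|\mathfrak D|_{\mathbf G}=\bigcap\{\mathfrak D'\subseteq\mathfrak D\mid\mathfrak D'\in\mathbf G\}$; material iff $\mathfrak D=|\mathfrak D|_{\mathbf G}$; $|\mathbf G|$ = material designs of $\mathbf G$. A $\maltese$-shorten of a chronicle $\mathfrak c$ is $\mathfrak c$ or $\mathfrak c_1\maltese$ where $\mathfrak c=\mathfrak c_1\mathfrak c_2$, $\mathfrak c_1$ ending negatively; $E^{\maltese}$ = designs obtained from designs of $E$ by $\maltese$-shortening chronicles. $E$ is principal if its elements are $\maltese$-free and $|E^{\perp\perp}|=E^{\maltese}$. Naturals: $\overline0=\epsilon$, $\overline{k+1}=\overline k.0.1$; $\mathbf 0_\tau=\{(+,\tau,\emptyset)\}$, $(\mathbf{k+1})_\tau$ = prefix closure of $\{(+,\tau,\{0\})(-,\tau.0,\{1\})\mathfrak c\mid \mathfrak c\in\mathbf k_{\tau.0.1}\}$. Lists: $\mathfrak D^{\epsilon}_\xi=\{(+,\xi,\emptyset)\}$ and for $n>0$, $\mathfrak D^{\langle a_1,\dots,a_n\rangle}_\xi$ is the prefix closure of $\{(+,\xi,\{0,1\})(-,\xi.0,\{1\})\mathfrak c\mid\mathfrak c\in(\mathbf a_1)_{\xi.0.1}\}\cup\{(+,\xi,\{0,1\})(-,\xi.1,\{1\})\mathfrak c\mid \mathfrak c\in\mathfrak D^{\langle a_2,\dots,a_n\rangle}_{\xi.1.1}\}$. -}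

module Defs where

open import Level using (Lift)
open import Data.Nat using (ℕ; zero; suc; _<_)
open import Data.List using (List; []; _∷_; _++_; [_]; map; mapMaybe)
open import Data.List.Membership.Propositional using (_∈_)
open import Data.List.Relation.Unary.All using (All)
open import Data.List.Relation.Unary.Linked using (Linked)
open import Data.List.Relation.Unary.Unique.Propositional using (Unique)
open import Data.Maybe using (Maybe; just; nothing)
open import Data.Vec using (Vec; toList)
open import Data.Product using (Σ; ∃; _×_; _,_)
open import Data.Sum using (_⊎_)
open import Data.Empty using (⊥)
open import Data.Unit using (⊤)
open import Relation.Nullary using (¬_)
open import Relation.Binary.PropositionalEquality using (_≡_; _≢_)

Address : Set
Address = List ℕ

infixl 20 _∙_
_∙_ : Address → ℕ → Address
ξ ∙ i = ξ ++ [ i ]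

-- A ramification is a finite set of naturals, represented canonically
-- as a strictly increasing list (enforced in `Chronicle`).
Ramification : Set
Ramification = List ℕ

data Action : Set where
  pos    : Address → Ramification → Action
  neg    : Address → Ramification → Action
  daimon : Action

Positive : Action → Set
Positive (pos _ _) = ⊤
Positive (neg _ _) = ⊥
Positive daimon    = ⊤

Negative : Action → Set
Negative (pos _ _) = ⊥
Negative (neg _ _) = ⊤
Negative daimon    = ⊥

addr : Action → Maybe Address
addr (pos σ _) = just σ
addr (neg σ _) = just σ
addr daimon    = nothing

RamOK : Action → Set
RamOK (pos _ I) = Linked _<_ I
RamOK (neg _ I) = Linked _<_ I
RamOK daimon    = ⊤

JustBy : Action → Action → Set
JustBy (pos σ _) (neg ζ J) = Σ ℕ λ i → i ∈ J × σ ≡ ζ ∙ i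
JustBy (neg σ _) (pos ζ J) = Σ ℕ λ i → i ∈ J × σ ≡ ζ ∙ i
JustBy _ _ = ⊥

Opposite : Action → Action → Set
Opposite a b = (Positive a × Negative b) ⊎ (Negative a × Positive b)

Alternating : List Action → Set
Alternating []           = ⊤
Alternating (a ∷ [])     = ⊤
Alternating (a ∷ b ∷ s)  = Opposite a b × Alternating (b ∷ s)

EndsPositive : List Action → Set
EndsPositive s = Σ (List Action) λ u → Σ Action λ a → s ≡ u ++ [ a ] × Positive a

EndsNegative : List Action → Set
EndsNegative s = Σ (List Action) λ u → Σ Action λ a → s ≡ u ++ [ a ] × Negative a

ActionOK : Maybe Address → List Address → List Action → Action → Set
ActionOK Γ Δ u (neg σ I) =
  (u ≡ [] × Γ ≡ just σ)
  ⊎ (Σ (List Action) λ u' → Σ Action λ b → u ≡ u' ++ [ b ] × JustBy (neg σ I) b)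
ActionOK Γ Δ u (pos σ I) =
  σ ∈ Δ ⊎ (Σ Action λ b → b ∈ u × JustBy (pos σ I) b)
ActionOK Γ Δ u daimon = ⊤

-- A chronicle on base Γ ⊢ Δ  (Γ : at most one address)
record Chronicle (Γ : Maybe Address) (Δ : List Address) (s : List Action) : Set where
  field
    nonempty    : s ≢ []
    alternating : Alternating s
    daimonLast  : ∀ u v → s ≡ u ++ daimon ∷ v → v ≡ []
    ramOK       : All RamOK s
    negStart    : ∀ ξ → Γ ≡ just ξ → Σ Action λ a → Σ (List Action) λ s' → s ≡ a ∷ s' × Negative a
    actionsOK   : ∀ u a v → s ≡ u ++ a ∷ v → ActionOK Γ Δ u a
    distinct    : Unique (mapMaybe addr s)

AddrDisjoint : List Action → List Action → Set
AddrDisjoint u v = ∀ x y → x ∈ u → y ∈ v → ∀ σ → addr x ≡ just σ → addr y ≢ just σ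

Coherent : List Action → List Action → Set
Coherent [] _ = ⊤
Coherent (_ ∷ _) [] = ⊤
Coherent (a ∷ u) (b ∷ v) =
  (a ≡ b × Coherent u v)
  ⊎ (a ≢ b × Negative a × Negative b × (addr a ≢ addr b → AddrDisjoint (a ∷ u) (b ∷ v)))

ChrSet : Set₁
ChrSet = List Action → Set

_⊆_ : ChrSet → ChrSet → Set
D ⊆ D' = ∀ c → D c → D' c

_≐_ : ChrSet → ChrSet → Set
D ≐ D' = D ⊆ D' × D' ⊆ D

_≼_ : List Action → List Action → Set
d ≼ c = Σ (List Action) λ e → d ++ e ≡ c

PrefixClosure : ChrSet → ChrSet
PrefixClosure S d = d ≢ [] × (Σ (List Action) λ c → S c × d ≼ c)

Maximal : ChrSet → List Action → Set
Maximal D c = ∀ d → D d → c ≼ d → d ≡ c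

record IsDesign (Γ : Maybe Address) (Δ : List Address) (D : ChrSet) : Set where
  field
    chronicles   : ∀ c → D c → Chronicle Γ Δ c
    prefixClosed : ∀ c d → D (c ++ d) → c ≢ [] → D c
    coherent     : ∀ c c' → D c → D c' → Coherent c c'
    maxPositive  : ∀ c → D c → Maximal D c → EndsPositive c
    posBase      : Γ ≡ nothing →
                   (Σ (List Action) λ c → D c)
                   × (Σ Action λ a → Positive a × (∀ c → D c → Σ (List Action) λ c' → c ≡ a ∷ c'))

DaimonFree : ChrSet → Set
DaimonFree D = ∀ c → D c → ¬ (daimon ∈ c)

strip : Action → ChrSet → ChrSet
strip a D c = D (a ∷ c)

-- negative members of the net: a set of chronicles together with the
-- (not yet used) addresses on which it is cut
Net : Set₁
Net = List (ChrSet × List Address)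

-- Conv P net : the interaction of the cut-net (positive design P,
-- negative components net) terminates with result {✠}
data Conv : ChrSet → Net → Set₁ where
  done : ∀ {P net} → P [ daimon ] → Conv P net
  step : ∀ {P net} (σ : Address) (I : Ramification) →
         P [ pos σ I ] →
         (pre post : Net) (N : ChrSet) (rs₁ rs₂ : List Address) →
         net ≡ pre ++ (N , rs₁ ++ σ ∷ rs₂) ∷ post →
         N [ neg σ I ] →
         Conv (strip (neg σ I) N)
              ((strip (pos σ I) P , map (σ ∙_) I) ∷ pre ++ (N , rs₁ ++ rs₂) ∷ post) →
         Conv P net

-- orthogonality of D on ⊢ ξ with R on ξ ⊢
Orth : Address → ChrSet → ChrSet → Set₁
Orth ξ D R = Conv D ((R , [ ξ ]) ∷ [])

DesignSet : Set₂
DesignSet = ChrSet → Set₁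

-- E^⊥ for a set E of designs on ⊢ ξ : designs on ξ ⊢
PerpPos : Address → DesignSet → DesignSet
PerpPos ξ E R = IsDesign (just ξ) [] R × (∀ D → E D → Orth ξ D R)

-- F^⊥ for a set F of designs on ξ ⊢ : designs on ⊢ ξ
PerpNeg : Address → DesignSet → DesignSet
PerpNeg ξ F D = IsDesign nothing [ ξ ] D × (∀ R → F R → Orth ξ D R)

Biorth : Address → DesignSet → DesignSet
Biorth ξ E = PerpNeg ξ (PerpPos ξ E)

-- D is material in G :  D = |D|_G = ⋂ { D' ⊆ D | D' ∈ G }
Material : DesignSet → ChrSet → Set₁
Material G D = ∀ c → D c → ∀ D' → D' ⊆ D → G D' → D' c

Incarnation : DesignSet → DesignSet
Incarnation G D = G D × Material G D

DaimonShorten : List Action → List Action → Set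
DaimonShorten c d =
  d ≡ c
  ⊎ (Σ (List Action) λ c₁ → Σ (List Action) λ c₂ →
       c ≡ c₁ ++ c₂ × (c₁ ≡ [] ⊎ EndsNegative c₁) × d ≡ c₁ ++ [ daimon ])

DaimonShortenings : Address → DesignSet → DesignSet
DaimonShortenings ξ E D' =
  IsDesign nothing [ ξ ] D'
  × Σ ChrSet λ D → E D
  × Σ ((c : List Action) → D c → List Action) λ f →
      (∀ c (p : D c) → DaimonShorten c (f c p))
      × (D' ≐ PrefixClosure (λ d → Σ (List Action) λ c → Σ (D c) λ p → d ≡ f c p))

Principal : Address → DesignSet → Set₁
Principal ξ E =
  (∀ D → E D → DaimonFree D)
  × (∀ D → (Incarnation (Biorth ξ E) D → DaimonShortenings ξ E D)
         × (DaimonShortenings ξ E D → Incarnation (Biorth ξ E) D))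

NatD : ℕ → Address → ChrSet
NatD zero    τ c = c ≡ [ pos τ [] ]
NatD (suc k) τ = PrefixClosure λ c →
  Σ (List Action) λ c' → NatD k (τ ∙ 0 ∙ 1) c' × c ≡ pos τ [ 0 ] ∷ neg (τ ∙ 0) [ 1 ] ∷ c'

ListD : List ℕ → Address → ChrSet
ListD []       ξ c = c ≡ [ pos ξ [] ]
ListD (a ∷ as) ξ = PrefixClosure λ c →
  (Σ (List Action) λ c' → NatD a (ξ ∙ 0 ∙ 1) c'
      × c ≡ pos ξ (0 ∷ 1 ∷ []) ∷ neg (ξ ∙ 0) [ 1 ] ∷ c')
  ⊎ (Σ (List Action) λ c' → ListD as (ξ ∙ 1 ∙ 1) c'
      × c ≡ pos ξ (0 ∷ 1 ∷ []) ∷ neg (ξ ∙ 1) [ 1 ] ∷ c')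

-- 𝕃ₙ (membership up to extensional equality of chronicle sets)
L : Address → ℕ → DesignSet
L ξ n D = Lift _ (Σ (Vec ℕ n) λ as → D ≐ ListD (toList as) ξ)

module Submission where

-- A partial list is a list of naturals whose spine may be interrupted by the
-- daimon ✠; its chronicles form a design 𝔇ˢ, and the lists of 𝕃ₙ are exactly
-- the ✠-free partial lists.
-- A material D thus equals the 𝔇ˢ extracted from it, so D ∈ 𝕃ₙ^✠; a ✠-shortening
-- D' lies in 𝕃ₙ^⊥⊥ by (1) and is material by (4) and (6).

open import Defs
open import Level using (lift)
open import Data.Nat using (ℕ; zero; suc; _<_; _≤_; s≤s; z≤n)
open import Data.Nat.Properties using (+-comm; ≤-reflexive; ≤-refl; ≤-trans; <-irrefl; <-trans; <⇒≤; <⇒≢; <-≤-trans)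
open import Data.List using (List; []; _∷_; _++_; [_]; map; mapMaybe; length)
open import Data.List.Properties using (++-assoc; ∷-injective; ∷-injectiveˡ; ∷-injectiveʳ; mapMaybe-++; length-++; ++-identityʳ; ++-conicalˡ; ++-conicalʳ; ++-identityʳ-unique)
open import Data.List.Membership.Propositional using (_∈_)
open import Data.List.Membership.Propositional.Properties using (∈-++⁺ˡ; ∈-++⁺ʳ; ∈-++⁻; ∈-map⁻)
open import Data.List.Relation.Unary.Any using (here; there)
open import Data.List.Relation.Unary.All using (All; []; _∷_)
import Data.List.Relation.Unary.All as All
import Data.List.Relation.Unary.All.Properties as All
open import Data.List.Relation.Unary.Linked using (Linked; []; [-]; _∷_)
open import Data.List.Relation.Unary.AllPairs using ([]; _∷_)
open import Data.List.Relation.Unary.Unique.Propositional using (Unique)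
open import Data.Vec using (Vec; toList; replicate) renaming ([] to []ᵥ; _∷_ to _∷ᵥ_)
open import Data.Maybe using (just; nothing)
open import Data.Product using (Σ; _×_; _,_; proj₁; proj₂)
open import Data.Sum using (_⊎_; inj₁; inj₂)
open import Data.Empty using (⊥; ⊥-elim)
open import Data.Unit using (⊤; tt)
open import Relation.Nullary using (¬_)
open import Relation.Binary.PropositionalEquality using (_≡_; _≢_; refl; sym; trans; cong; subst)

positive-not-negative : ∀ {a} → Positive a → Negative a → ⊥
positive-not-negative {pos _ _} _ ()
positive-not-negative {neg _ _} () _
positive-not-negative {daimon}  _ ()

endsNeg-[] : ¬ EndsNegative []
endsNeg-[] ([]    , _ , () , _)
endsNeg-[] (_ ∷ _ , _ , () , _)

endsNeg-∷ : ∀ {x r} → EndsNegative r → EndsNegative (x ∷ r)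
endsNeg-∷ (u , a , refl , na) = _ ∷ u , a , refl , na

endsNeg-dropPos : ∀ {x r} → EndsNegative (x ∷ r) → Positive x → EndsNegative r
endsNeg-dropPos ([]    , a , refl , na) px = ⊥-elim (positive-not-negative px na)
endsNeg-dropPos (_ ∷ u , a , refl , na) px = u , a , refl , na

endsNeg-drop : ∀ {x y r} → EndsNegative (x ∷ y ∷ r) → EndsNegative (y ∷ r)
endsNeg-drop ([]    , a , () , na)
endsNeg-drop (_ ∷ u , a , eq , na) = u , a , ∷-injectiveʳ eq , na

endsNeg-singleton : ∀ {y} → EndsNegative [ y ] → Negative y
endsNeg-singleton ([]            , a , refl , na) = na
endsNeg-singleton (_ ∷ []        , a , () , _)
endsNeg-singleton (_ ∷ _ ∷ _     , a , () , _)

endsNeg-prefix-singleton : ∀ {c₁ c₂ x} → EndsNegative c₁ → c₁ ++ c₂ ≡ [ x ] →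
  c₁ ≡ [ x ] × Negative x
endsNeg-prefix-singleton {[]}             en eq   = ⊥-elim (endsNeg-[] en)
endsNeg-prefix-singleton {y ∷ []} {[]}    en refl = refl , endsNeg-singleton en
endsNeg-prefix-singleton {y ∷ []} {_ ∷ _} en ()
endsNeg-prefix-singleton {y ∷ z ∷ r}      en ()

-- ✠ may shorten after the empty prefix or after a negative action, never after
-- a lone positive one.
EmptyOrEndsNeg : List Action → Set
EmptyOrEndsNeg c = c ≡ [] ⊎ EndsNegative c

emptyOrEndsNeg-drop₂ : ∀ {x y r} → EmptyOrEndsNeg (x ∷ y ∷ r) → EmptyOrEndsNeg r
emptyOrEndsNeg-drop₂ {r = []}    _        = inj₁ refl
emptyOrEndsNeg-drop₂ {r = _ ∷ _} (inj₁ ())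
emptyOrEndsNeg-drop₂ {r = _ ∷ _} (inj₂ en) = inj₂ (endsNeg-drop (endsNeg-drop en))

emptyOrEndsNeg-pos : ∀ {σ I} → ¬ EmptyOrEndsNeg [ pos σ I ]
emptyOrEndsNeg-pos (inj₁ ())
emptyOrEndsNeg-pos (inj₂ en) = endsNeg-singleton en

emptyOrEndsNeg-∷₂ : ∀ {x y c} → Negative y → EmptyOrEndsNeg c → EndsNegative (x ∷ y ∷ c)
emptyOrEndsNeg-∷₂ ny (inj₁ refl) = [ _ ] , _ , refl , ny
emptyOrEndsNeg-∷₂ ny (inj₂ en)   = endsNeg-∷ (endsNeg-∷ en)

snoc≢[] : ∀ (c : List Action) z → c ++ [ z ] ≢ []
snoc≢[] c z eq with ++-conicalʳ c [ z ] eq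
... | ()

snoc≢self : ∀ (c : List Action) z → c ++ [ z ] ≢ c
snoc≢self c z eq with ++-identityʳ-unique c (sym eq)
... | ()

Coh : ChrSet → Set
Coh X = ∀ c c' → X c → X c' → Coherent c c'

coh-strip : ∀ {X} a → Coh X → Coh (strip a X)
coh-strip a co c c' p q with co (a ∷ c) (a ∷ c') p q
... | inj₁ (_ , r)  = r
... | inj₂ (ne , _) = ⊥-elim (ne refl)

incoherent-✠-pos : ∀ {σ I r r'} → ¬ Coherent (daimon ∷ r) (pos σ I ∷ r')
incoherent-✠-pos (inj₁ (() , _))
incoherent-✠-pos (inj₂ (_ , () , _))

incoherent-pos-pos : ∀ {σ I J r r'} → I ≢ J → ¬ Coherent (pos σ I ∷ r) (pos σ J ∷ r')
incoherent-pos-pos ne (inj₁ (refl , _)) = ne refl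
incoherent-pos-pos ne (inj₂ (_ , () , _))

EndsPosOrExtends : ChrSet → List Action → Set
EndsPosOrExtends X c = EndsPositive c ⊎ Σ Action λ z → X (c ++ [ z ])

endsPos-∷₂ : ∀ {x y r} → EndsPositive r → EndsPositive (x ∷ y ∷ r)
endsPos-∷₂ (u , a , refl , pa) = _ ∷ _ ∷ u , a , refl , pa

maximal-endsPos : ∀ {X : ChrSet} c → EndsPosOrExtends X c → Maximal X c → EndsPositive c
maximal-endsPos c (inj₁ ep)      mx = ep
maximal-endsPos c (inj₂ (z , q)) mx = ⊥-elim (snoc≢self c z (mx (c ++ [ z ]) q ([ z ] , refl)))

NonEmpty : ChrSet → ChrSet
NonEmpty X c = c ≢ [] × X c

endsPosOrExtends-nonEmpty : ∀ {X c} → EndsPosOrExtends X c → EndsPosOrExtends (NonEmpty X) c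
endsPosOrExtends-nonEmpty     (inj₁ ep)      = inj₁ ep
endsPosOrExtends-nonEmpty {c = c} (inj₂ (z , q)) = inj₂ (z , snoc≢[] c z , q)

ShortensPos : ChrSet → ChrSet → Set
ShortensPos P' P = ∀ c → P c → P' c ⊎
  (Σ (List Action) λ c₁ → Σ (List Action) λ c₂ → c ≡ c₁ ++ c₂
     × (c₁ ≡ [] ⊎ (EndsNegative c₁ × P' c₁)) × P' (c₁ ++ [ daimon ]))

ShortensNeg : ChrSet → ChrSet → Set
ShortensNeg N' N = ∀ c → N c → N' c ⊎
  (Σ (List Action) λ c₁ → Σ (List Action) λ c₂ → c ≡ c₁ ++ c₂
     × EndsNegative c₁ × N' c₁ × N' (c₁ ++ [ daimon ]))

-- After a positive step (σ, I) the positive design becomes a negative component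
-- of the net; after the matching negative step the cut partner becomes positive.
shortensPos-strip : ∀ {P' P σ I} → ShortensPos P' P → Coh P' → P' [ pos σ I ] →
  ShortensNeg (strip (pos σ I) P') (strip (pos σ I) P)
shortensPos-strip {σ = σ} {I} sh co p' c pc with sh (pos σ I ∷ c) pc
... | inj₁ x = inj₁ x
... | inj₂ (c₁ , c₂ , eq , inj₁ refl , d) = ⊥-elim (incoherent-✠-pos (co _ _ d p'))
... | inj₂ ([] , c₂ , eq , inj₂ (en , q) , d) = ⊥-elim (endsNeg-[] en)
... | inj₂ (x ∷ c₁ , c₂ , refl , inj₂ (en , q) , d) =
  inj₂ (c₁ , c₂ , refl , endsNeg-dropPos en tt , q , d)

shortensNeg-strip : ∀ {N' N σ I} → ShortensNeg N' N →
  ShortensPos (strip (neg σ I) N') (strip (neg σ I) N)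
shortensNeg-strip {σ = σ} {I} sh c nc with sh (neg σ I ∷ c) nc
... | inj₁ x = inj₁ x
... | inj₂ ([] , c₂ , eq , en , q , d) = ⊥-elim (endsNeg-[] en)
... | inj₂ (x ∷ [] , c₂ , refl , en , q , d) = inj₂ ([] , c , refl , inj₁ refl , d)
... | inj₂ (x ∷ y ∷ c₁ , c₂ , refl , en , q , d) =
  inj₂ (y ∷ c₁ , c₂ , refl , inj₂ (endsNeg-drop en , q) , d)

shortensNeg-initial : ∀ {N' N a} → ShortensNeg N' N → N [ a ] → N' [ a ]
shortensNeg-initial sh n with sh _ n
... | inj₁ x = x
... | inj₂ (c₁ , c₂ , eq , en , q , d) with endsNeg-prefix-singleton en (sym eq)
... | refl , _ = q

data ShortensNet : Net → Net → Set₁ where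
  []  : ShortensNet [] []
  _∷_ : ∀ {N' N rs net' net} → ShortensNeg N' N × Coh N' → ShortensNet net' net →
        ShortensNet ((N' , rs) ∷ net') ((N , rs) ∷ net)

shortensNet-split : ∀ pre {post N rs net'} → ShortensNet net' (pre ++ (N , rs) ∷ post) →
  Σ Net λ pre' → Σ ChrSet λ N' → Σ Net λ post' →
    net' ≡ pre' ++ (N' , rs) ∷ post' × ShortensNet pre' pre
    × (ShortensNeg N' N × Coh N') × ShortensNet post' post
shortensNet-split []        (s ∷ r) = [] , _ , _ , refl , [] , s , r
shortensNet-split (_ ∷ pre) (s ∷ r) with shortensNet-split pre r
... | pre' , N' , post' , refl , r₁ , sN , r₂ = _ ∷ pre' , N' , post' , refl , s ∷ r₁ , sN , r₂

shortensNet-join : ∀ {pre' pre post' post N' N rs} → ShortensNet pre' pre →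
  ShortensNeg N' N × Coh N' → ShortensNet post' post →
  ShortensNet (pre' ++ (N' , rs) ∷ post') (pre ++ (N , rs) ∷ post)
shortensNet-join []       s r = s ∷ r
shortensNet-join (t ∷ r₁) s r = t ∷ shortensNet-join r₁ s r

-- The simulation: the shortened net follows the original interaction until the
-- positive component meets one of its inserted daimons.
conv-shorten : ∀ {P net} → Conv P net →
  ∀ {P' net'} → ShortensPos P' P → Coh P' → ShortensNet net' net → Conv P' net'
conv-shorten (done d) sh co r with sh [ daimon ] d
... | inj₁ d' = done d'
... | inj₂ (c₁ , c₂ , eq , inj₁ refl , d') = done d'
... | inj₂ (c₁ , c₂ , eq , inj₂ (en , _) , _) with endsNeg-prefix-singleton en (sym eq)
... | _ , ()
conv-shorten (step σ I p pre post N rs₁ rs₂ refl n c) sh co r with sh [ pos σ I ] p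
... | inj₂ (c₁ , c₂ , eq , inj₁ refl , d') = done d'
... | inj₂ (c₁ , c₂ , eq , inj₂ (en , _) , _) with endsNeg-prefix-singleton en (sym eq)
... | _ , ()
conv-shorten (step σ I p pre post N rs₁ rs₂ refl n c) sh co r | inj₁ p'
  with shortensNet-split pre r
... | pre' , N' , post' , refl , r₁ , (shN , coN) , r₂ =
  step σ I p' pre' post' N' rs₁ rs₂ refl (shortensNeg-initial shN n)
    (conv-shorten c (shortensNeg-strip shN) (coh-strip _ coN)
      ((shortensPos-strip sh co p' , coh-strip _ co) ∷ shortensNet-join r₁ (shN , coN) r₂))

shortens-biorth : ∀ {ξ E D D'} → E D → ShortensPos D' D → IsDesign nothing [ ξ ] D' →
  Biorth ξ E D'
shortens-biorth {D = D} eD sh des' = des' , λ R pr →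
  conv-shorten (proj₂ pr D eD) sh (IsDesign.coherent des')
    (((λ c p → inj₁ p) , IsDesign.coherent (proj₁ pr)) ∷ [])

-- Partial naturals and partial lists: the spine of a natural (resp. list) may
-- be cut by ✠.  Their chronicles are described by cons-recursive predicates;
-- the primed versions describe what follows the first positive action.

data PNat : Set where
  stopN : PNat
  zeroN : PNat
  sucN  : PNat → PNat

data PList : ℕ → Set where
  stopL : ∀ {n} → PList n
  nilL  : PList zero
  consL : ∀ {n} → PNat → PList n → PList (suc n)

nat : ℕ → PNat
nat zero    = zeroN
nat (suc a) = sucN (nat a)

list : ∀ {n} → Vec ℕ n → PList n
list []ᵥ       = nilL
list (a ∷ᵥ as) = consL (nat a) (list as)

-- A partial list is a ✠-shortening of the list obtained by reading ✠ as 0.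
natValue : PNat → ℕ
natValue stopN    = zero
natValue zeroN    = zero
natValue (sucN h) = suc (natValue h)

listValue : ∀ {n} → PList n → Vec ℕ n
listValue {n} stopL = replicate n zero
listValue nilL        = []ᵥ
listValue (consL h t) = natValue h ∷ᵥ listValue t

mutual
  NatChr : PNat → Address → List Action → Set
  NatChr h        τ []      = ⊤
  NatChr stopN    τ (x ∷ r) = x ≡ daimon × r ≡ []
  NatChr zeroN    τ (x ∷ r) = x ≡ pos τ [] × r ≡ []
  NatChr (sucN h) τ (x ∷ r) = x ≡ pos τ [ 0 ] × NatChr′ h τ r

  NatChr′ : PNat → Address → List Action → Set
  NatChr′ h τ []      = ⊤
  NatChr′ h τ (y ∷ r) = y ≡ neg (τ ∙ 0) [ 1 ] × NatChr h (τ ∙ 0 ∙ 1) r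

mutual
  ListChr : ∀ {n} → PList n → Address → List Action → Set
  ListChr s           ξ []      = ⊤
  ListChr stopL       ξ (x ∷ r) = x ≡ daimon × r ≡ []
  ListChr nilL        ξ (x ∷ r) = x ≡ pos ξ [] × r ≡ []
  ListChr (consL h t) ξ (x ∷ r) = x ≡ pos ξ (0 ∷ 1 ∷ []) × ListChr′ h t ξ r

  ListChr′ : ∀ {n} → PNat → PList n → Address → List Action → Set
  ListChr′ h t ξ []      = ⊤
  ListChr′ h t ξ (y ∷ r) =
    (y ≡ neg (ξ ∙ 0) [ 1 ] × NatChr h (ξ ∙ 0 ∙ 1) r)
    ⊎ (y ≡ neg (ξ ∙ 1) [ 1 ] × ListChr t (ξ ∙ 1 ∙ 1) r)

PartialListD : ∀ {n} → PList n → Address → ChrSet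
PartialListD s ξ = NonEmpty (ListChr s ξ)

natChr-prefix : ∀ h τ c d → NatChr h τ (c ++ d) → NatChr h τ c
natChr-prefix h        τ []          d p             = tt
natChr-prefix stopN    τ (x ∷ c)     d (e , q)       = e , ++-conicalˡ c d q
natChr-prefix zeroN    τ (x ∷ c)     d (e , q)       = e , ++-conicalˡ c d q
natChr-prefix (sucN h) τ (x ∷ [])    d (e , q)       = e , tt
natChr-prefix (sucN h) τ (x ∷ y ∷ c) d (e , e' , q)  = e , e' , natChr-prefix h _ c d q

listChr-prefix : ∀ {n} (s : PList n) ξ c d → ListChr s ξ (c ++ d) → ListChr s ξ c
listChr-prefix s           ξ []          d p                  = tt
listChr-prefix stopL       ξ (x ∷ c)     d (e , q)            = e , ++-conicalˡ c d q
listChr-prefix nilL        ξ (x ∷ c)     d (e , q)            = e , ++-conicalˡ c d q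
listChr-prefix (consL h t) ξ (x ∷ [])    d (e , q)            = e , tt
listChr-prefix (consL h t) ξ (x ∷ y ∷ c) d (e , inj₁ (e' , q)) = e , inj₁ (e' , natChr-prefix h _ c d q)
listChr-prefix (consL h t) ξ (x ∷ y ∷ c) d (e , inj₂ (e' , q)) = e , inj₂ (e' , listChr-prefix t _ c d q)

natChr-✠-free : ∀ a τ c → NatChr (nat a) τ c → ¬ (daimon ∈ c)
natChr-✠-free zero    τ (x ∷ r)     (refl , refl)    (here ())
natChr-✠-free (suc a) τ (x ∷ r)     (refl , q)       (here ())
natChr-✠-free (suc a) τ (x ∷ y ∷ r) (refl , refl , q) (there (here ()))
natChr-✠-free (suc a) τ (x ∷ y ∷ r) (refl , refl , q) (there (there m)) = natChr-✠-free a _ r q m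

listChr-✠-free : ∀ {n} (v : Vec ℕ n) ξ c → ListChr (list v) ξ c → ¬ (daimon ∈ c)
listChr-✠-free []ᵥ      ξ (x ∷ r)     (refl , refl)              (here ())
listChr-✠-free (a ∷ᵥ v) ξ (x ∷ r)     (refl , q)                 (here ())
listChr-✠-free (a ∷ᵥ v) ξ (x ∷ y ∷ r) (refl , inj₁ (refl , q))   (there (here ()))
listChr-✠-free (a ∷ᵥ v) ξ (x ∷ y ∷ r) (refl , inj₁ (refl , q))   (there (there m)) = natChr-✠-free a _ r q m
listChr-✠-free (a ∷ᵥ v) ξ (x ∷ y ∷ r) (refl , inj₂ (refl , q))   (there (here ()))
listChr-✠-free (a ∷ᵥ v) ξ (x ∷ y ∷ r) (refl , inj₂ (refl , q))   (there (there m)) = listChr-✠-free v _ r q m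

natD-natChr : ∀ a τ c → NatD a τ c → NatChr (nat a) τ c
natD-natChr zero    τ c refl = refl , refl
natD-natChr (suc a) τ c (_ , _ , (c' , d' , refl) , e , eq) =
  natChr-prefix (nat (suc a)) τ c e
    (subst (NatChr (nat (suc a)) τ) (sym eq) (refl , refl , natD-natChr a _ c' d'))

listD-listChr : ∀ {n} (v : Vec ℕ n) ξ c → ListD (toList v) ξ c → ListChr (list v) ξ c
listD-listChr []ᵥ      ξ c refl = refl , refl
listD-listChr (a ∷ᵥ v) ξ c (_ , _ , inj₁ (c' , d' , refl) , e , eq) =
  listChr-prefix (list (a ∷ᵥ v)) ξ c e
    (subst (ListChr (list (a ∷ᵥ v)) ξ) (sym eq) (refl , inj₁ (refl , natD-natChr a _ c' d')))
listD-listChr (a ∷ᵥ v) ξ c (_ , _ , inj₂ (c' , d' , refl) , e , eq) =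
  listChr-prefix (list (a ∷ᵥ v)) ξ c e
    (subst (ListChr (list (a ∷ᵥ v)) ξ) (sym eq) (refl , inj₂ (refl , listD-listChr v _ c' d')))

listD-nonempty : ∀ as ξ c → ListD as ξ c → c ≢ []
listD-nonempty []       ξ c refl ()
listD-nonempty (a ∷ as) ξ c (ne , _) = ne

-- Conversely every chronicle of nat a (list v) extends to one of k_τ (𝔇^v_ξ):
-- complete it along the head spine.
natSpine : ℕ → Address → List Action
natSpine zero    τ = [ pos τ [] ]
natSpine (suc a) τ = pos τ [ 0 ] ∷ neg (τ ∙ 0) [ 1 ] ∷ natSpine a (τ ∙ 0 ∙ 1)

natSpine-natD : ∀ a τ → NatD a τ (natSpine a τ)
natSpine-natD zero    τ = refl
natSpine-natD (suc a) τ = (λ ()) , _ , (_ , natSpine-natD a _ , refl) , [] , ++-identityʳ _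

listSpine : List ℕ → Address → List Action
listSpine []       ξ = [ pos ξ [] ]
listSpine (a ∷ as) ξ = pos ξ (0 ∷ 1 ∷ []) ∷ neg (ξ ∙ 0) [ 1 ] ∷ natSpine a (ξ ∙ 0 ∙ 1)

listSpine-listD : ∀ as ξ → ListD as ξ (listSpine as ξ)
listSpine-listD []       ξ = refl
listSpine-listD (a ∷ as) ξ = (λ ()) , _ , inj₁ (_ , natSpine-natD a _ , refl) , [] , ++-identityʳ _

natChr-complete : ∀ a τ c → NatChr (nat a) τ c → Σ (List Action) λ e → NatD a τ (c ++ e)
natChr-complete a       τ []          p               = natSpine a τ , natSpine-natD a τ
natChr-complete zero    τ (x ∷ r)     (refl , refl)    = [] , refl
natChr-complete (suc a) τ (x ∷ [])    (refl , tt)      =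
  _ , (λ ()) , _ , (_ , natSpine-natD a _ , refl) , [] , ++-identityʳ _
natChr-complete (suc a) τ (x ∷ y ∷ r) (refl , refl , q) with natChr-complete a _ r q
... | e , d = e , (λ ()) , _ , (_ , d , refl) , [] , ++-identityʳ _

listChr-complete : ∀ {n} (v : Vec ℕ n) ξ c → ListChr (list v) ξ c →
  Σ (List Action) λ e → ListD (toList v) ξ (c ++ e)
listChr-complete v        ξ []          p             = listSpine (toList v) ξ , listSpine-listD (toList v) ξ
listChr-complete []ᵥ      ξ (x ∷ r)     (refl , refl)  = [] , refl
listChr-complete (a ∷ᵥ v) ξ (x ∷ [])    (refl , tt)    =
  _ , (λ ()) , _ , inj₁ (_ , natSpine-natD a _ , refl) , [] , ++-identityʳ _
listChr-complete (a ∷ᵥ v) ξ (x ∷ y ∷ r) (refl , inj₁ (refl , q)) with natChr-complete a _ r q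
... | e , d = e , (λ ()) , _ , inj₁ (_ , d , refl) , [] , ++-identityʳ _
listChr-complete (a ∷ᵥ v) ξ (x ∷ y ∷ r) (refl , inj₂ (refl , q)) with listChr-complete v _ r q
... | e , d = e , (λ ()) , _ , inj₂ (_ , d , refl) , [] , ++-identityʳ _

listChr-listD : ∀ {n} (v : Vec ℕ n) ξ c → c ≢ [] → ListChr (list v) ξ c → ListD (toList v) ξ c
listChr-listD []ᵥ      ξ []      ne p             = ⊥-elim (ne refl)
listChr-listD []ᵥ      ξ (x ∷ r) ne (refl , refl) = refl
listChr-listD (a ∷ᵥ v) ξ c       ne p with listChr-complete (a ∷ᵥ v) ξ c p
... | e , (_ , c₀ , s , e' , eq) = ne , c₀ , s , e ++ e' , trans (sym (++-assoc c e e')) eq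

-- 𝔇ˢ is a design as soon as it is contained in one (which supplies the
-- chronicle conditions and coherence); its own structure gives the rest.

firstAction : ∀ {n} → PList n → Address → Action
firstAction stopL       ξ = daimon
firstAction nilL        ξ = pos ξ []
firstAction (consL h t) ξ = pos ξ (0 ∷ 1 ∷ [])

firstAction-listChr : ∀ {n} (s : PList n) ξ → ListChr s ξ [ firstAction s ξ ]
firstAction-listChr stopL       ξ = refl , refl
firstAction-listChr nilL        ξ = refl , refl
firstAction-listChr (consL h t) ξ = refl , tt

firstAction-positive : ∀ {n} (s : PList n) ξ → Positive (firstAction s ξ)
firstAction-positive stopL       ξ = tt
firstAction-positive nilL        ξ = tt
firstAction-positive (consL h t) ξ = tt

firstAction-head : ∀ {n} (s : PList n) ξ x r → ListChr s ξ (x ∷ r) → x ≡ firstAction s ξ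
firstAction-head stopL       ξ x r (e , _) = e
firstAction-head nilL        ξ x r (e , _) = e
firstAction-head (consL h t) ξ x r (e , _) = e

natFirstAction : PNat → Address → Action
natFirstAction stopN    τ = daimon
natFirstAction zeroN    τ = pos τ []
natFirstAction (sucN h) τ = pos τ [ 0 ]

natFirstAction-natChr : ∀ h τ → NatChr h τ [ natFirstAction h τ ]
natFirstAction-natChr stopN    τ = refl , refl
natFirstAction-natChr zeroN    τ = refl , refl
natFirstAction-natChr (sucN h) τ = refl , tt

natChr-endsPosOrExtends : ∀ h τ c → c ≢ [] → NatChr h τ c → EndsPosOrExtends (NatChr h τ) c
natChr-endsPosOrExtends h        τ []              ne p             = ⊥-elim (ne refl)
natChr-endsPosOrExtends stopN    τ (x ∷ r)         ne (refl , refl) = inj₁ ([] , _ , refl , tt)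
natChr-endsPosOrExtends zeroN    τ (x ∷ r)         ne (refl , refl) = inj₁ ([] , _ , refl , tt)
natChr-endsPosOrExtends (sucN h) τ (x ∷ [])        ne (refl , _)    = inj₁ ([] , _ , refl , tt)
natChr-endsPosOrExtends (sucN h) τ (x ∷ y ∷ [])    ne (refl , refl , _) =
  inj₂ (_ , refl , refl , natFirstAction-natChr h _)
natChr-endsPosOrExtends (sucN h) τ (x ∷ y ∷ z ∷ r) ne (refl , refl , q)
  with natChr-endsPosOrExtends h _ (z ∷ r) (λ ()) q
... | inj₁ ep       = inj₁ (endsPos-∷₂ ep)
... | inj₂ (w , q') = inj₂ (w , refl , refl , q')

listChr-endsPosOrExtends : ∀ {n} (s : PList n) ξ c → c ≢ [] → ListChr s ξ c →
  EndsPosOrExtends (ListChr s ξ) c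
listChr-endsPosOrExtends s           ξ []      ne p             = ⊥-elim (ne refl)
listChr-endsPosOrExtends stopL       ξ (x ∷ r) ne (refl , refl) = inj₁ ([] , _ , refl , tt)
listChr-endsPosOrExtends nilL        ξ (x ∷ r) ne (refl , refl) = inj₁ ([] , _ , refl , tt)
listChr-endsPosOrExtends (consL h t) ξ (x ∷ []) ne (refl , _)   = inj₁ ([] , _ , refl , tt)
listChr-endsPosOrExtends (consL h t) ξ (x ∷ y ∷ []) ne (refl , inj₁ (refl , _)) =
  inj₂ (_ , refl , inj₁ (refl , natFirstAction-natChr h _))
listChr-endsPosOrExtends (consL h t) ξ (x ∷ y ∷ []) ne (refl , inj₂ (refl , _)) =
  inj₂ (_ , refl , inj₂ (refl , firstAction-listChr t _))
listChr-endsPosOrExtends (consL h t) ξ (x ∷ y ∷ z ∷ r) ne (refl , inj₁ (refl , q))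
  with natChr-endsPosOrExtends h _ (z ∷ r) (λ ()) q
... | inj₁ ep       = inj₁ (endsPos-∷₂ ep)
... | inj₂ (w , q') = inj₂ (w , refl , inj₁ (refl , q'))
listChr-endsPosOrExtends (consL h t) ξ (x ∷ y ∷ z ∷ r) ne (refl , inj₂ (refl , q))
  with listChr-endsPosOrExtends t _ (z ∷ r) (λ ()) q
... | inj₁ ep       = inj₁ (endsPos-∷₂ ep)
... | inj₂ (w , q') = inj₂ (w , refl , inj₂ (refl , q'))

partialListD-design : ∀ {n} ξ (s : PList n) D → IsDesign nothing [ ξ ] D →
  PartialListD s ξ ⊆ D → IsDesign nothing [ ξ ] (PartialListD s ξ)
partialListD-design ξ s D des sub = record
  { chronicles   = λ c p → IsDesign.chronicles des c (sub c p)
  ; prefixClosed = λ c d p ne → ne , listChr-prefix s ξ c d (proj₂ p)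
  ; coherent     = λ c c' p q → IsDesign.coherent des c c' (sub c p) (sub c' q)
  ; maxPositive  = λ c p → maximal-endsPos c
      (endsPosOrExtends-nonEmpty {ListChr s ξ} (listChr-endsPosOrExtends s ξ c (proj₁ p) (proj₂ p)))
  ; posBase      = λ _ → (_ , (λ ()) , firstAction-listChr s ξ)
                         , firstAction s ξ , firstAction-positive s ξ , startsWithFirst
  }
  where
    startsWithFirst : ∀ c → PartialListD s ξ c → Σ (List Action) λ c' → c ≡ firstAction s ξ ∷ c'
    startsWithFirst []      (ne , _) = ⊥-elim (ne refl)
    startsWithFirst (x ∷ r) (_ , q)  = r , cong (_∷ r) (firstAction-head s ξ x r q)

-- A chain starting with a negative action on ξ is a chronicle on ξ ⊢; this is
-- how the testers below are seen to be designs.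

Answers : Action → Action → Set
Answers (neg σ I) (pos σ' J) = JustBy (pos σ' J) (neg σ I) × Linked _<_ J
Answers (pos σ I) (neg σ' J) = JustBy (neg σ' J) (pos σ I) × Linked _<_ J
Answers (neg σ I) daimon     = ⊤
Answers _         _          = ⊥

Chain : Action → List Action → Set
Chain p []      = ⊤
Chain p (x ∷ r) = Answers p x × Chain x r

chain-alternating : ∀ p r → Chain p r → Alternating (p ∷ r)
chain-alternating p         []               _       = tt
chain-alternating (pos σ I) (neg _ _ ∷ r)    (_ , c) = inj₁ (tt , tt) , chain-alternating _ r c
chain-alternating (neg σ I) (pos _ _ ∷ r)    (_ , c) = inj₂ (tt , tt) , chain-alternating _ r c
chain-alternating (neg σ I) (daimon ∷ r)     (_ , c) = inj₂ (tt , tt) , chain-alternating _ r c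
chain-alternating (pos σ I) (pos _ _ ∷ r)    (() , _)
chain-alternating (pos σ I) (daimon ∷ r)     (() , _)
chain-alternating (neg σ I) (neg _ _ ∷ r)    (() , _)
chain-alternating daimon    (x ∷ r)          (() , _)

chain-✠-last : ∀ p r → Chain p r → ∀ u v → p ∷ r ≡ u ++ daimon ∷ v → v ≡ []
chain-✠-last .daimon []      c        []          .[] refl = refl
chain-✠-last .daimon (x ∷ r) (() , _) []          _   refl
chain-✠-last p       []      c        (y ∷ [])    v   ()
chain-✠-last p       []      c        (y ∷ z ∷ u) v   ()
chain-✠-last p       (x ∷ r) (_ , c)  (y ∷ u)     v   eq = chain-✠-last x r c u v (∷-injectiveʳ eq)

chain-ramifications : ∀ p r → RamOK p → Chain p r → All RamOK (p ∷ r)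
chain-ramifications p         []            rp c              = rp ∷ []
chain-ramifications (pos σ I) (neg _ _ ∷ r) rp ((_ , l) , c)  = rp ∷ chain-ramifications _ r l c
chain-ramifications (neg σ I) (pos _ _ ∷ r) rp ((_ , l) , c)  = rp ∷ chain-ramifications _ r l c
chain-ramifications (neg σ I) (daimon ∷ r)  rp (_ , c)        = rp ∷ chain-ramifications _ r tt c
chain-ramifications (pos σ I) (pos _ _ ∷ r) rp (() , _)
chain-ramifications (pos σ I) (daimon ∷ r)  rp (() , _)
chain-ramifications (neg σ I) (neg _ _ ∷ r) rp (() , _)
chain-ramifications daimon    (x ∷ r)       rp (() , _)

answers-actionOK : ∀ Γ Δ pre p x → Answers p x → ActionOK Γ Δ (pre ++ [ p ]) x
answers-actionOK Γ Δ pre (neg σ I) (pos σ' J) (j , _) = inj₂ (neg σ I , ∈-++⁺ʳ pre (here refl) , j)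
answers-actionOK Γ Δ pre (pos σ I) (neg σ' J) (j , _) = inj₂ (pre , pos σ I , refl , j)
answers-actionOK Γ Δ pre (neg σ I) daimon     _       = tt
answers-actionOK Γ Δ pre (pos σ I) (pos σ' J) ()
answers-actionOK Γ Δ pre (pos σ I) daimon     ()
answers-actionOK Γ Δ pre (neg σ I) (neg σ' J) ()
answers-actionOK Γ Δ pre daimon    x          ()

chain-actionOK : ∀ Γ Δ pre p r → Chain p r → ∀ u a v → r ≡ u ++ a ∷ v → ActionOK Γ Δ (pre ++ p ∷ u) a
chain-actionOK Γ Δ pre p (x ∷ r) (s , c) []      a v refl = answers-actionOK Γ Δ pre p x s
chain-actionOK Γ Δ pre p (x ∷ r) (s , c) (y ∷ u) a v eq with ∷-injective eq
... | refl , eq' = subst (λ w → ActionOK Γ Δ w a) (++-assoc pre [ p ] (x ∷ u))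
                     (chain-actionOK Γ Δ (pre ++ [ p ]) x r c u a v eq')

length-∙ : ∀ σ i → length (σ ∙ i) ≡ suc (length σ)
length-∙ σ i = trans (length-++ σ) (+-comm (length σ) 1)

shorter-∙ : ∀ σ i → length σ < length (σ ∙ i)
shorter-∙ σ i = ≤-reflexive (sym (length-∙ σ i))

prepend-longer : ∀ σ i {r} → All (λ σ' → length (σ ∙ i) < length σ') r × Unique r →
  All (λ σ' → length σ < length σ') (σ ∙ i ∷ r) × Unique (σ ∙ i ∷ r)
prepend-longer σ i (al , u) = shorter-∙ σ i ∷ All.map (<-trans (shorter-∙ σ i)) al
                  , All.map (λ lt eq → <⇒≢ lt (cong length eq)) al ∷ u

-- Along a chain addresses strictly grow in length, hence are pairwise distinct.
chain-addresses : ∀ p r σ → addr p ≡ just σ → Chain p r →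
  All (λ σ' → length σ < length σ') (mapMaybe addr r) × Unique (mapMaybe addr r)
chain-addresses p         []                σ  e    c        = [] , []
chain-addresses (neg σ I) (daimon ∷ [])     .σ refl _        = [] , []
chain-addresses (neg σ I) (daimon ∷ x ∷ r)  .σ refl (_ , () , _)
chain-addresses (neg σ I) (pos σ' J ∷ r)    .σ refl (((i , _ , refl) , _) , c) =
  prepend-longer σ i (chain-addresses (pos σ' J) r σ' refl c)
chain-addresses (pos σ I) (neg σ' J ∷ r)    .σ refl (((i , _ , refl) , _) , c) =
  prepend-longer σ i (chain-addresses (neg σ' J) r σ' refl c)
chain-addresses (pos σ I) (pos _ _ ∷ r)     .σ refl (() , _)
chain-addresses (pos σ I) (daimon ∷ r)      .σ refl (() , _)
chain-addresses (neg σ I) (neg _ _ ∷ r)     .σ refl (() , _)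

NegChain : Address → List Action → Set
NegChain ξ []      = ⊥
NegChain ξ (x ∷ r) = Σ Ramification λ I → x ≡ neg ξ I × Linked _<_ I × Chain x r

negChain-chronicle : ∀ ξ c → NegChain ξ c → Chronicle (just ξ) [] c
negChain-chronicle ξ (x ∷ r) (I , refl , l , ch) = record
  { nonempty    = λ ()
  ; alternating = chain-alternating _ r ch
  ; daimonLast  = chain-✠-last _ r ch
  ; ramOK       = chain-ramifications _ r l ch
  ; negStart    = λ { ξ' refl → _ , r , refl , tt }
  ; actionsOK   = actionsOK
  ; distinct    = distinct
  }
  where
    actionsOK : ∀ u a v → neg ξ I ∷ r ≡ u ++ a ∷ v → ActionOK (just ξ) [] u a
    actionsOK []      a v refl = inj₁ (refl , refl)
    actionsOK (y ∷ u) a v eq with ∷-injective eq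
    ... | refl , eq' = chain-actionOK (just ξ) [] [] _ r ch u a v eq'
    distinct : Unique (mapMaybe addr (neg ξ I ∷ r))
    distinct with chain-addresses (neg ξ I) r ξ refl ch
    ... | al , u = All.map (λ lt eq → <⇒≢ lt (cong length eq)) al ∷ u

-- For every position t of a list of length n there is a negative
-- design on ξ ⊢ which follows a list down to position t (entering the tail with
-- (ξ.1,{1})), then reads the natural found there (or checks the end of the list)
-- and answers its final positive action by ✠.

data Position : ℕ → Set where
  atNil  : Position zero
  atHead : ∀ {n} → Position (suc n)
  inTail : ∀ {n} → Position n → Position (suc n)

UpTo✠ : List Action → Set
UpTo✠ r = r ≡ [] ⊎ r ≡ [ daimon ]

mutual
  NatTester : Address → List Action → Set
  NatTester τ []      = ⊤
  NatTester τ (x ∷ r) = (x ≡ neg τ [] × UpTo✠ r) ⊎ (x ≡ neg τ [ 0 ] × NatTester′ τ r)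

  NatTester′ : Address → List Action → Set
  NatTester′ τ []      = ⊤
  NatTester′ τ (y ∷ r) = y ≡ pos (τ ∙ 0) [ 1 ] × NatTester (τ ∙ 0 ∙ 1) r

mutual
  ListTester : ∀ {n} → Position n → Address → List Action → Set
  ListTester t          ξ []      = ⊤
  ListTester atNil      ξ (x ∷ r) = x ≡ neg ξ [] × UpTo✠ r
  ListTester atHead     ξ (x ∷ r) = x ≡ neg ξ (0 ∷ 1 ∷ []) × HeadTester ξ r
  ListTester (inTail t) ξ (x ∷ r) = x ≡ neg ξ (0 ∷ 1 ∷ []) × TailTester t ξ r

  HeadTester : Address → List Action → Set
  HeadTester ξ []      = ⊤
  HeadTester ξ (y ∷ r) = y ≡ pos (ξ ∙ 0) [ 1 ] × NatTester (ξ ∙ 0 ∙ 1) r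

  TailTester : ∀ {n} → Position n → Address → List Action → Set
  TailTester t ξ []      = ⊤
  TailTester t ξ (y ∷ r) = y ≡ pos (ξ ∙ 1) [ 1 ] × ListTester t (ξ ∙ 1 ∙ 1) r

Tester : ∀ {n} → Position n → Address → ChrSet
Tester t ξ = NonEmpty (ListTester t ξ)

upTo✠-chain : ∀ σ I r → UpTo✠ r → Chain (neg σ I) r
upTo✠-chain σ I .[]         (inj₁ refl) = tt
upTo✠-chain σ I .([ daimon ]) (inj₂ refl) = tt , tt

natTester-chain : ∀ σ r → NatTester (σ ∙ 1) r → Chain (pos σ [ 1 ]) r
natTester-chain σ []          p                        = tt
natTester-chain σ (x ∷ r)     (inj₁ (refl , q))        = ((1 , here refl , refl) , []) , upTo✠-chain _ _ r q
natTester-chain σ (x ∷ [])    (inj₂ (refl , q))        = ((1 , here refl , refl) , [-]) , tt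
natTester-chain σ (x ∷ y ∷ r) (inj₂ (refl , refl , q)) =
  ((1 , here refl , refl) , [-]) , ((0 , here refl , refl) , [-]) , natTester-chain _ r q

mutual
  listTester-chain : ∀ {n} (t : Position n) σ r → ListTester t (σ ∙ 1) r → Chain (pos σ [ 1 ]) r
  listTester-chain t          σ []      p          = tt
  listTester-chain atNil      σ (x ∷ r) (refl , q) = ((1 , here refl , refl) , []) , upTo✠-chain _ _ r q
  listTester-chain atHead     σ (x ∷ r) (refl , q) =
    ((1 , here refl , refl) , (s≤s z≤n ∷ [-])) , headTester-chain _ r q
  listTester-chain (inTail t) σ (x ∷ r) (refl , q) =
    ((1 , here refl , refl) , (s≤s z≤n ∷ [-])) , tailTester-chain t _ r q

  headTester-chain : ∀ ξ r → HeadTester ξ r → Chain (neg ξ (0 ∷ 1 ∷ [])) r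
  headTester-chain ξ []      p          = tt
  headTester-chain ξ (y ∷ r) (refl , q) = ((0 , here refl , refl) , [-]) , natTester-chain _ r q

  tailTester-chain : ∀ {n} (t : Position n) ξ r → TailTester t ξ r → Chain (neg ξ (0 ∷ 1 ∷ [])) r
  tailTester-chain t ξ []      p          = tt
  tailTester-chain t ξ (y ∷ r) (refl , q) = ((1 , there (here refl) , refl) , [-]) , listTester-chain t _ r q

listTester-negChain : ∀ {n} (t : Position n) ξ c → c ≢ [] → ListTester t ξ c → NegChain ξ c
listTester-negChain t          ξ []      ne p          = ne refl
listTester-negChain atNil      ξ (x ∷ r) ne (refl , q) = [] , refl , [] , upTo✠-chain _ _ r q
listTester-negChain atHead     ξ (x ∷ r) ne (refl , q) = _ , refl , s≤s z≤n ∷ [-] , headTester-chain _ r q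
listTester-negChain (inTail t) ξ (x ∷ r) ne (refl , q) = _ , refl , s≤s z≤n ∷ [-] , tailTester-chain t _ r q

upTo✠-prefix : ∀ c d → UpTo✠ (c ++ d) → UpTo✠ c
upTo✠-prefix []          d _          = inj₁ refl
upTo✠-prefix (x ∷ c)     d (inj₁ ())
upTo✠-prefix (x ∷ [])    d (inj₂ refl) = inj₂ refl
upTo✠-prefix (x ∷ y ∷ c) d (inj₂ ())

natTester-prefix : ∀ τ c d → NatTester τ (c ++ d) → NatTester τ c
natTester-prefix τ []          d p                      = tt
natTester-prefix τ (x ∷ c)     d (inj₁ (e , q))         = inj₁ (e , upTo✠-prefix c d q)
natTester-prefix τ (x ∷ [])    d (inj₂ (e , q))         = inj₂ (e , tt)
natTester-prefix τ (x ∷ y ∷ c) d (inj₂ (e , e' , q))    = inj₂ (e , e' , natTester-prefix _ c d q)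

listTester-prefix : ∀ {n} (t : Position n) ξ c d → ListTester t ξ (c ++ d) → ListTester t ξ c
listTester-prefix t          ξ []          d p            = tt
listTester-prefix atNil      ξ (x ∷ c)     d (e , q)      = e , upTo✠-prefix c d q
listTester-prefix atHead     ξ (x ∷ [])    d (e , q)      = e , tt
listTester-prefix atHead     ξ (x ∷ y ∷ c) d (e , e' , q) = e , e' , natTester-prefix _ c d q
listTester-prefix (inTail t) ξ (x ∷ [])    d (e , q)      = e , tt
listTester-prefix (inTail t) ξ (x ∷ y ∷ c) d (e , e' , q) = e , e' , listTester-prefix t _ c d q

-- Testers are coherent: two chronicles can only diverge on the first action of
-- a natural tester, whose two possible actions share their address.
upTo✠-coherent : ∀ r r' → UpTo✠ r → UpTo✠ r' → Coherent r r'
upTo✠-coherent .[]         r'          (inj₁ refl) q           = tt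
upTo✠-coherent .([ daimon ]) .[]         (inj₂ refl) (inj₁ refl) = tt
upTo✠-coherent .([ daimon ]) .([ daimon ]) (inj₂ refl) (inj₂ refl) = inj₁ (refl , tt)

natTester-coherent : ∀ τ c c' → NatTester τ c → NatTester τ c' → Coherent c c'
natTester-coherent τ []      c'       p q = tt
natTester-coherent τ (x ∷ c) []       p q = tt
natTester-coherent τ (x ∷ c) (x' ∷ c') (inj₁ (refl , p)) (inj₁ (refl , q)) =
  inj₁ (refl , upTo✠-coherent c c' p q)
natTester-coherent τ (x ∷ c) (x' ∷ c') (inj₁ (refl , p)) (inj₂ (refl , q)) =
  inj₂ ((λ ()) , tt , tt , λ ne → ⊥-elim (ne refl))
natTester-coherent τ (x ∷ c) (x' ∷ c') (inj₂ (refl , p)) (inj₁ (refl , q)) =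
  inj₂ ((λ ()) , tt , tt , λ ne → ⊥-elim (ne refl))
natTester-coherent τ (x ∷ [])    (x' ∷ c')       (inj₂ (refl , p)) (inj₂ (refl , q)) = inj₁ (refl , tt)
natTester-coherent τ (x ∷ y ∷ c) (x' ∷ [])       (inj₂ (refl , p)) (inj₂ (refl , q)) = inj₁ (refl , tt)
natTester-coherent τ (x ∷ y ∷ c) (x' ∷ y' ∷ c') (inj₂ (refl , refl , p)) (inj₂ (refl , refl , q)) =
  inj₁ (refl , inj₁ (refl , natTester-coherent _ c c' p q))

listTester-coherent : ∀ {n} (t : Position n) ξ c c' → ListTester t ξ c → ListTester t ξ c' → Coherent c c'
listTester-coherent t          ξ []          c'             p q = tt
listTester-coherent t          ξ (x ∷ c)     []             p q = tt
listTester-coherent atNil      ξ (x ∷ c)     (x' ∷ c')      (refl , p) (refl , q) =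
  inj₁ (refl , upTo✠-coherent c c' p q)
listTester-coherent atHead     ξ (x ∷ [])    (x' ∷ c')      (refl , p) (refl , q) = inj₁ (refl , tt)
listTester-coherent atHead     ξ (x ∷ y ∷ c) (x' ∷ [])      (refl , p) (refl , q) = inj₁ (refl , tt)
listTester-coherent atHead     ξ (x ∷ y ∷ c) (x' ∷ y' ∷ c') (refl , refl , p) (refl , refl , q) =
  inj₁ (refl , inj₁ (refl , natTester-coherent _ c c' p q))
listTester-coherent (inTail t) ξ (x ∷ [])    (x' ∷ c')      (refl , p) (refl , q) = inj₁ (refl , tt)
listTester-coherent (inTail t) ξ (x ∷ y ∷ c) (x' ∷ [])      (refl , p) (refl , q) = inj₁ (refl , tt)
listTester-coherent (inTail t) ξ (x ∷ y ∷ c) (x' ∷ y' ∷ c') (refl , refl , p) (refl , refl , q) =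
  inj₁ (refl , inj₁ (refl , listTester-coherent t _ c c' p q))

natTester-endsPosOrExtends : ∀ τ c → c ≢ [] → NatTester τ c → EndsPosOrExtends (NatTester τ) c
natTester-endsPosOrExtends τ []              ne p = ⊥-elim (ne refl)
natTester-endsPosOrExtends τ (x ∷ .[])       ne (inj₁ (refl , inj₁ refl)) =
  inj₂ (daimon , inj₁ (refl , inj₂ refl))
natTester-endsPosOrExtends τ (x ∷ .([ daimon ])) ne (inj₁ (refl , inj₂ refl)) =
  inj₁ ([ _ ] , daimon , refl , tt)
natTester-endsPosOrExtends τ (x ∷ [])        ne (inj₂ (refl , p)) = inj₂ (_ , inj₂ (refl , refl , tt))
natTester-endsPosOrExtends τ (x ∷ y ∷ [])    ne (inj₂ (refl , refl , p)) = inj₁ ([ _ ] , _ , refl , tt)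
natTester-endsPosOrExtends τ (x ∷ y ∷ z ∷ c) ne (inj₂ (refl , refl , p))
  with natTester-endsPosOrExtends _ (z ∷ c) (λ ()) p
... | inj₁ ep      = inj₁ (endsPos-∷₂ ep)
... | inj₂ (w , q) = inj₂ (w , inj₂ (refl , refl , q))

listTester-endsPosOrExtends : ∀ {n} (t : Position n) ξ c → c ≢ [] → ListTester t ξ c →
  EndsPosOrExtends (ListTester t ξ) c
listTester-endsPosOrExtends t ξ [] ne p = ⊥-elim (ne refl)
listTester-endsPosOrExtends atNil ξ (x ∷ .[]) ne (refl , inj₁ refl) = inj₂ (daimon , refl , inj₂ refl)
listTester-endsPosOrExtends atNil ξ (x ∷ .([ daimon ])) ne (refl , inj₂ refl) =
  inj₁ ([ _ ] , daimon , refl , tt)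
listTester-endsPosOrExtends atHead ξ (x ∷ []) ne (refl , p) = inj₂ (_ , refl , refl , tt)
listTester-endsPosOrExtends atHead ξ (x ∷ y ∷ []) ne (refl , refl , p) = inj₁ ([ _ ] , _ , refl , tt)
listTester-endsPosOrExtends atHead ξ (x ∷ y ∷ z ∷ c) ne (refl , refl , p)
  with natTester-endsPosOrExtends _ (z ∷ c) (λ ()) p
... | inj₁ ep      = inj₁ (endsPos-∷₂ ep)
... | inj₂ (w , q) = inj₂ (w , refl , refl , q)
listTester-endsPosOrExtends (inTail t) ξ (x ∷ []) ne (refl , p) = inj₂ (_ , refl , refl , tt)
listTester-endsPosOrExtends (inTail t) ξ (x ∷ y ∷ []) ne (refl , refl , p) = inj₁ ([ _ ] , _ , refl , tt)
listTester-endsPosOrExtends (inTail t) ξ (x ∷ y ∷ z ∷ c) ne (refl , refl , p)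
  with listTester-endsPosOrExtends t _ (z ∷ c) (λ ()) p
... | inj₁ ep      = inj₁ (endsPos-∷₂ ep)
... | inj₂ (w , q) = inj₂ (w , refl , refl , q)

tester-design : ∀ {n} (t : Position n) ξ → IsDesign (just ξ) [] (Tester t ξ)
tester-design t ξ = record
  { chronicles   = λ c p → negChain-chronicle ξ c (listTester-negChain t ξ c (proj₁ p) (proj₂ p))
  ; prefixClosed = λ c d p ne → ne , listTester-prefix t ξ c d (proj₂ p)
  ; coherent     = λ c c' p q → listTester-coherent t ξ c c' (proj₂ p) (proj₂ q)
  ; maxPositive  = λ c p → maximal-endsPos c
      (endsPosOrExtends-nonEmpty {ListTester t ξ} (listTester-endsPosOrExtends t ξ c (proj₁ p) (proj₂ p)))
  ; posBase      = λ ()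
  }

-- Interaction of a natural (list) with a tester, inside an arbitrary net: the
-- two follow the same spine until the tester plays ✠.
natTester-orth : ∀ a τ (P N : ChrSet) rest → NonEmpty (NatChr (nat a) τ) ⊆ P →
  NonEmpty (NatTester τ) ⊆ N → Conv P ((N , [ τ ]) ∷ rest)
natTester-orth zero τ P N rest hP hN =
  step τ [] (hP _ ((λ ()) , refl , refl)) [] rest N [] [] refl (hN _ ((λ ()) , inj₁ (refl , inj₁ refl)))
    (done (hN _ ((λ ()) , inj₁ (refl , inj₂ refl))))
natTester-orth (suc a) τ P N rest hP hN =
  step τ [ 0 ] (hP _ ((λ ()) , refl , tt)) [] rest N [] [] refl (hN _ ((λ ()) , inj₂ (refl , tt)))
    (step (τ ∙ 0) [ 1 ] (hN _ ((λ ()) , inj₂ (refl , refl , tt))) [] ((N , []) ∷ rest)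
      (strip (pos τ [ 0 ]) P) [] [] refl (hP _ ((λ ()) , refl , refl , tt))
      (natTester-orth a (τ ∙ 0 ∙ 1) _ _ _ (λ c q → hP _ ((λ ()) , refl , refl , proj₂ q))
         (λ c q → hN _ ((λ ()) , inj₂ (refl , refl , proj₂ q)))))

listTester-orth : ∀ {n} (t : Position n) (v : Vec ℕ n) ξ (P N : ChrSet) rest →
  PartialListD (list v) ξ ⊆ P → Tester t ξ ⊆ N → Conv P ((N , [ ξ ]) ∷ rest)
listTester-orth atNil []ᵥ ξ P N rest hP hN =
  step ξ [] (hP _ ((λ ()) , refl , refl)) [] rest N [] [] refl (hN _ ((λ ()) , refl , inj₁ refl))
    (done (hN _ ((λ ()) , refl , inj₂ refl)))
listTester-orth atHead (a ∷ᵥ v) ξ P N rest hP hN =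
  step ξ (0 ∷ 1 ∷ []) (hP _ ((λ ()) , refl , tt)) [] rest N [] [] refl (hN _ ((λ ()) , refl , tt))
    (step (ξ ∙ 0) [ 1 ] (hN _ ((λ ()) , refl , refl , tt)) [] ((N , []) ∷ rest)
      (strip (pos ξ (0 ∷ 1 ∷ [])) P) [] [ ξ ∙ 1 ] refl (hP _ ((λ ()) , refl , inj₁ (refl , tt)))
      (natTester-orth a (ξ ∙ 0 ∙ 1) _ _ _ (λ c q → hP _ ((λ ()) , refl , inj₁ (refl , proj₂ q)))
         (λ c q → hN _ ((λ ()) , refl , refl , proj₂ q))))
listTester-orth (inTail t) (a ∷ᵥ v) ξ P N rest hP hN =
  step ξ (0 ∷ 1 ∷ []) (hP _ ((λ ()) , refl , tt)) [] rest N [] [] refl (hN _ ((λ ()) , refl , tt))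
    (step (ξ ∙ 1) [ 1 ] (hN _ ((λ ()) , refl , refl , tt)) [] ((N , []) ∷ rest)
      (strip (pos ξ (0 ∷ 1 ∷ [])) P) [ ξ ∙ 0 ] [] refl (hP _ ((λ ()) , refl , inj₂ (refl , tt)))
      (listTester-orth t v (ξ ∙ 1 ∙ 1) _ _ _ (λ c q → hP _ ((λ ()) , refl , inj₂ (refl , proj₂ q)))
         (λ c q → hN _ ((λ ()) , refl , refl , proj₂ q))))

tester-perp : ∀ {n} (t : Position n) ξ → PerpPos ξ (L ξ n) (Tester t ξ)
tester-perp t ξ = tester-design t ξ , λ { D (lift (v , _ , D⊇v)) →
  listTester-orth t v ξ D (Tester t ξ) []
    (λ c p → D⊇v c (listChr-listD v ξ c (proj₁ p) (proj₂ p))) (λ c p → p) }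

-- Extraction of a partial list from a design D₀ of 𝕃ₙ^⊥⊥, which converges
-- against every tester; these interactions are followed in parallel.  The state
-- of an interaction is a positive component P lying above a chronicle path of D₀,
-- cut against the tester on a single address τ, while every other component of
-- the net is cut on addresses shorter than τ.

CutBelow : ℕ → Net → Set₁
CutBelow k net = All (λ x → All (λ σ → length σ < k) (proj₂ x)) net

cutBelow-weaken : ∀ {k k'} → k ≤ k' → ∀ net → CutBelow k net → CutBelow k' net
cutBelow-weaken le net s = All.map (All.map (λ lt → <-≤-trans lt le)) s

cut-at-head : ∀ {x rest} pre {post N rs₁ σ rs₂ k} → x ∷ rest ≡ pre ++ (N , rs₁ ++ σ ∷ rs₂) ∷ post →
  CutBelow k rest → k ≤ length σ → pre ≡ [] × x ≡ (N , rs₁ ++ σ ∷ rs₂) × post ≡ rest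
cut-at-head []        refl s le = refl , refl , refl
cut-at-head (p ∷ pre) {rs₁ = rs₁} refl s le =
  ⊥-elim (<-irrefl refl (<-≤-trans (All.head (All.++⁻ʳ rs₁ (All.head (All.++⁻ʳ pre s)))) le))

singleton-split : ∀ {A : Set} {x y : A} rs₁ rs₂ → [ x ] ≡ rs₁ ++ y ∷ rs₂ → rs₁ ≡ [] × rs₂ ≡ []
singleton-split []          []      refl = refl , refl
singleton-split []          (_ ∷ _) ()
singleton-split (_ ∷ [])    rs₂     ()
singleton-split (_ ∷ _ ∷ _) rs₂     ()

unique-snoc : ∀ {A : Set} (xs : List A) {y} → Unique (xs ++ [ y ]) → ¬ (y ∈ xs)
unique-snoc (x ∷ xs) (al ∷ u) (here refl) = All.head (All.++⁻ʳ xs al) refl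
unique-snoc (x ∷ xs) (al ∷ u) (there m)   = unique-snoc xs u m

-- The number of steps of an interaction; it bounds the extraction of naturals.
depth : ∀ {P net} → Conv P net → ℕ
depth (done _)                      = 0
depth (step _ _ _ _ _ _ _ _ _ _ c) = suc (depth c)

sucN-⊆ : ∀ τ h {P : ChrSet} → P [ pos τ [ 0 ] ] → P (pos τ [ 0 ] ∷ neg (τ ∙ 0) [ 1 ] ∷ []) →
  NonEmpty (NatChr h (τ ∙ 0 ∙ 1)) ⊆ strip (neg (τ ∙ 0) [ 1 ]) (strip (pos τ [ 0 ]) P) →
  NonEmpty (NatChr (sucN h) τ) ⊆ P
sucN-⊆ τ h p₁ p₂ h⊆ []              (ne , _)              = ⊥-elim (ne refl)
sucN-⊆ τ h p₁ p₂ h⊆ (x ∷ [])        (_ , refl , _)        = p₁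
sucN-⊆ τ h p₁ p₂ h⊆ (x ∷ y ∷ [])    (_ , refl , refl , _) = p₂
sucN-⊆ τ h p₁ p₂ h⊆ (x ∷ y ∷ z ∷ r) (_ , refl , refl , q) = h⊆ (z ∷ r) ((λ ()) , q)

consL-⊆ : ∀ {n} ξ h (s : PList n) {P : ChrSet} → P [ pos ξ (0 ∷ 1 ∷ []) ] →
  P (pos ξ (0 ∷ 1 ∷ []) ∷ neg (ξ ∙ 0) [ 1 ] ∷ []) → P (pos ξ (0 ∷ 1 ∷ []) ∷ neg (ξ ∙ 1) [ 1 ] ∷ []) →
  NonEmpty (NatChr h (ξ ∙ 0 ∙ 1)) ⊆ strip (neg (ξ ∙ 0) [ 1 ]) (strip (pos ξ (0 ∷ 1 ∷ [])) P) →
  PartialListD s (ξ ∙ 1 ∙ 1) ⊆ strip (neg (ξ ∙ 1) [ 1 ]) (strip (pos ξ (0 ∷ 1 ∷ [])) P) →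
  PartialListD (consL h s) ξ ⊆ P
consL-⊆ ξ h s p₁ p₂ p₃ h⊆ s⊆ []              (ne , _)                     = ⊥-elim (ne refl)
consL-⊆ ξ h s p₁ p₂ p₃ h⊆ s⊆ (x ∷ [])        (_ , refl , _)               = p₁
consL-⊆ ξ h s p₁ p₂ p₃ h⊆ s⊆ (x ∷ y ∷ [])    (_ , refl , inj₁ (refl , _)) = p₂
consL-⊆ ξ h s p₁ p₂ p₃ h⊆ s⊆ (x ∷ y ∷ z ∷ r) (_ , refl , inj₁ (refl , q)) = h⊆ (z ∷ r) ((λ ()) , q)
consL-⊆ ξ h s p₁ p₂ p₃ h⊆ s⊆ (x ∷ y ∷ [])    (_ , refl , inj₂ (refl , _)) = p₃
consL-⊆ ξ h s p₁ p₂ p₃ h⊆ s⊆ (x ∷ y ∷ z ∷ r) (_ , refl , inj₂ (refl , q)) = s⊆ (z ∷ r) ((λ ()) , q)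

⊆-singleton : ∀ {X P : ChrSet} {a} → (∀ x r → X (x ∷ r) → x ≡ a × r ≡ []) → P [ a ] → NonEmpty X ⊆ P
⊆-singleton shape p []      (ne , _) = ⊥-elim (ne refl)
⊆-singleton shape p (x ∷ r) (_ , q) with shape x r q
... | refl , refl = p

module Extraction (ξ₀ : Address) (D₀ : ChrSet) (D₀-design : IsDesign nothing [ ξ₀ ] D₀) where

  Above : ChrSet → List Action → Set
  Above P path = ∀ c → P c → D₀ (path ++ c)

  Fresh : List Action → Address → Set
  Fresh path τ = ∀ σ I → ActionOK nothing [ ξ₀ ] path (pos σ I) → σ ∈ mapMaybe addr path ⊎ σ ≡ τ

  above-extend : ∀ {P path a b} → Above P path → Above (strip b (strip a P)) (path ++ a ∷ b ∷ [])
  above-extend {path = path} {a} {b} ab c q = subst D₀ (sym (++-assoc path (a ∷ b ∷ []) c)) (ab _ q)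

  fresh-extend : ∀ {path τ I σ'} → Fresh path τ → Fresh (path ++ pos τ I ∷ neg σ' [ 1 ] ∷ []) (σ' ∙ 1)
  fresh-extend {path} {τ} {I} {σ'} fr σ J ok = used-or-fresh (justified ok)
    where
      used : ∀ {z} → z ∈ mapMaybe addr path ⊎ z ≡ τ → z ∈ mapMaybe addr path ++ τ ∷ σ' ∷ []
      used (inj₁ m)    = ∈-++⁺ˡ m
      used (inj₂ refl) = ∈-++⁺ʳ (mapMaybe addr path) (here refl)
      justified : ActionOK nothing [ ξ₀ ] (path ++ pos τ I ∷ neg σ' [ 1 ] ∷ []) (pos σ J) →
                  σ ∈ mapMaybe addr path ++ τ ∷ σ' ∷ [] ⊎ σ ≡ σ' ∙ 1
      justified (inj₁ m) = inj₁ (used (fr σ J (inj₁ m)))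
      justified (inj₂ (b , bm , j)) with ∈-++⁻ path bm
      ... | inj₁ bm'                 = inj₁ (used (fr σ J (inj₂ (b , bm' , j))))
      ... | inj₂ (here refl)         = ⊥-elim j
      ... | inj₂ (there (here refl)) with j
      ...   | i , here refl , e       = inj₂ e
      justified (inj₂ (b , bm , j)) | inj₂ (there (there ()))
      used-or-fresh : σ ∈ mapMaybe addr path ++ τ ∷ σ' ∷ [] ⊎ σ ≡ σ' ∙ 1 →
                      σ ∈ mapMaybe addr (path ++ pos τ I ∷ neg σ' [ 1 ] ∷ []) ⊎ σ ≡ σ' ∙ 1
      used-or-fresh (inj₁ m) = inj₁ (subst (σ ∈_) (sym (mapMaybe-++ addr path _)) m)
      used-or-fresh (inj₂ e) = inj₂ e

  -- Since addresses in a chronicle are distinct, the next positive action of D₀ is on τ.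
  positive-at-fresh : ∀ {P path τ σ I} → Above P path → Fresh path τ → P [ pos σ I ] → σ ≡ τ
  positive-at-fresh {path = path} {σ = σ} {I} ab fr p
    with IsDesign.chronicles D₀-design _ (ab _ p)
  ... | ch with fr σ I (Chronicle.actionsOK ch path (pos σ I) [] refl)
  ... | inj₂ e = e
  ... | inj₁ m = ⊥-elim (unique-snoc (mapMaybe addr path)
                   (subst Unique (mapMaybe-++ addr path [ pos σ I ]) (Chronicle.distinct ch)) m)

  above-coherent : ∀ {P path} → Above P path → Coh P
  above-coherent {path = path} ab c c' p q = drop path (IsDesign.coherent D₀-design _ _ (ab c p) (ab c' q))
    where drop : ∀ path → Coherent (path ++ c) (path ++ c') → Coherent c c'
          drop []         h                 = h
          drop (_ ∷ path) (inj₁ (_ , h))    = drop path h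
          drop (_ ∷ path) (inj₂ (ne , _))   = ⊥-elim (ne refl)

  D₀-move : ∀ {P N rest path τ} → Above P path → Fresh path τ → CutBelow (length τ) rest →
    (cv : Conv P ((N , [ τ ]) ∷ rest)) →
    P [ daimon ] ⊎ (Σ Ramification λ I → P [ pos τ I ] × N [ neg τ I ] ×
      Σ (Conv (strip (neg τ I) N) ((strip (pos τ I) P , map (τ ∙_) I) ∷ (N , []) ∷ rest)) λ cv' →
        depth cv' < depth cv)
  D₀-move ab fr cb (done d) = inj₁ d
  D₀-move ab fr cb (step σ I p pre post N' rs₁ rs₂ eq n c) with positive-at-fresh ab fr p
  ... | refl with cut-at-head pre eq cb ≤-refl
  ... | refl , e , refl with cong proj₁ e | singleton-split rs₁ rs₂ (cong proj₂ e)
  ... | refl | refl , refl = inj₂ (I , p , n , c , ≤-refl)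

  tester-move : ∀ {Q X rsH rest σ₀ I₀} → ¬ Q [ daimon ] →
    (∀ σ I → Q [ pos σ I ] → σ ≡ σ₀ × I ≡ I₀) → CutBelow (length σ₀) rest →
    (cv : Conv Q ((X , rsH) ∷ rest)) →
    Q [ pos σ₀ I₀ ] × X [ neg σ₀ I₀ ] × Σ (List Address) λ rs' → All (_∈ rsH) rs' ×
      Σ (Conv (strip (neg σ₀ I₀) X) ((strip (pos σ₀ I₀) Q , map (σ₀ ∙_) I₀) ∷ (X , rs') ∷ rest)) λ cv' →
        depth cv' < depth cv
  tester-move no✠ only cb (done d) = ⊥-elim (no✠ d)
  tester-move no✠ only cb (step σ I p pre post N' rs₁ rs₂ eq n c) with only σ I p
  ... | refl , refl with cut-at-head pre eq cb ≤-refl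
  ... | refl , e , refl with cong proj₁ e | cong proj₂ e
  ... | refl | refl = p , n , rs₁ ++ rs₂
                    , All.++⁺ (All.++⁻ˡ rs₁ mem) (All.tail (All.++⁻ʳ rs₁ mem)) , c , ≤-refl
    where mem = All.tabulate (λ m → m)

  tester-answer : ∀ τ J i {P N rest} → CutBelow (length τ) rest →
    ¬ N (neg τ J ∷ [ daimon ]) → (∀ σ I → N (neg τ J ∷ [ pos σ I ]) → σ ≡ τ ∙ i × I ≡ [ 1 ]) →
    (cv : Conv (strip (neg τ J) N) ((strip (pos τ J) P , map (τ ∙_) J) ∷ (N , []) ∷ rest)) →
    P (pos τ J ∷ neg (τ ∙ i) [ 1 ] ∷ []) × Σ Net λ rest' → CutBelow (length (τ ∙ i ∙ 1)) rest' ×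
      Σ (Conv (strip (neg (τ ∙ i) [ 1 ]) (strip (pos τ J) P))
              ((strip (pos (τ ∙ i) [ 1 ]) (strip (neg τ J) N) , [ τ ∙ i ∙ 1 ]) ∷ rest')) λ cv' →
        depth cv' < depth cv
  tester-answer τ J i {rest = rest} cb no✠ only cv
    with tester-move {σ₀ = τ ∙ i} no✠ only ([] ∷ cutBelow-weaken (<⇒≤ (shorter-∙ τ i)) rest cb) cv
  ... | _ , n , rs' , rs'⊆ , cv' , lt =
    n , _ , All.map shorter-than-τi1 rs'⊆ ∷ [] ∷ cutBelow-weaken τ≤τi1 rest cb , cv' , lt
    where
      τ≤τi1 : length τ ≤ length (τ ∙ i ∙ 1)
      τ≤τi1 = <⇒≤ (<-trans (shorter-∙ τ i) (shorter-∙ (τ ∙ i) 1))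
      shorter-than-τi1 : ∀ {σ} → σ ∈ map (τ ∙_) J → length σ < length (τ ∙ i ∙ 1)
      shorter-than-τi1 m with ∈-map⁻ (τ ∙_) m
      ... | j , _ , refl = subst (_< length (τ ∙ i ∙ 1)) (trans (length-∙ τ i) (sym (length-∙ τ j)))
                             (shorter-∙ (τ ∙ i) 1)

  -- Extraction of a partial natural at τ, by induction on (a bound k of) the
  -- length of the interaction.
  extract-nat : ∀ k τ (P N : ChrSet) rest path → (∀ c → N c → NatTester τ c) →
    CutBelow (length τ) rest → Above P path → Fresh path τ →
    (cv : Conv P ((N , [ τ ]) ∷ rest)) → depth cv < k →
    Σ PNat λ h → NonEmpty (NatChr h τ) ⊆ P
  extract-nat (suc k) τ P N rest path hN cb ab fr cv (s≤s lt) with D₀-move ab fr cb cv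
  ... | inj₁ d = stopN , ⊆-singleton {NatChr stopN τ} (λ _ _ q → q) d
  ... | inj₂ (I , p , n , cv' , lt₁) with hN _ n
  ...   | inj₁ (refl , _) = zeroN , ⊆-singleton {NatChr zeroN τ} (λ _ _ q → q) p
  ...   | inj₂ (refl , _) with tester-answer τ [ 0 ] 0 {P} cb (λ q → no✠ (hN _ q)) (λ _ _ q → next (hN _ q)) cv'
    where
      no✠ : ¬ NatTester τ (neg τ [ 0 ] ∷ [ daimon ])
      no✠ (inj₁ (() , _))
      no✠ (inj₂ (_ , () , _))
      next : ∀ {σ I} → NatTester τ (neg τ [ 0 ] ∷ [ pos σ I ]) → σ ≡ τ ∙ 0 × I ≡ [ 1 ]
      next (inj₁ (() , _))
      next (inj₂ (_ , refl , _)) = refl , refl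
  ...     | n₂ , rest' , cb' , cv'' , lt₂
            with extract-nat k (τ ∙ 0 ∙ 1) _ _ _ (path ++ pos τ [ 0 ] ∷ neg (τ ∙ 0) [ 1 ] ∷ [])
                   hN′ cb' (above-extend {P} ab) (fresh-extend fr) cv'' (≤-trans lt₂ (≤-trans (<⇒≤ lt₁) lt))
    where
      hN′ : ∀ c → N (neg τ [ 0 ] ∷ pos (τ ∙ 0) [ 1 ] ∷ c) → NatTester (τ ∙ 0 ∙ 1) c
      hN′ c q with hN _ q
      ... | inj₁ (() , _)
      ... | inj₂ (_ , _ , q') = q'
  ...       | h , h⊆ = sucN h , sucN-⊆ τ h p n₂ h⊆

  Run : ∀ {n} → Position n → Address → ChrSet → Set₁
  Run t ξ P = Σ ChrSet λ N → (∀ c → N c → ListTester t ξ c) × Σ Net λ rest →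
    CutBelow (length ξ) rest × Conv P ((N , [ ξ ]) ∷ rest)

  tail-runs : ∀ {m} ξ P path → Above P path → Fresh path ξ → (∀ (t : Position (suc m)) → Run t ξ P) →
    P [ pos ξ (0 ∷ 1 ∷ []) ] → (t : Position m) →
    P (pos ξ (0 ∷ 1 ∷ []) ∷ neg (ξ ∙ 1) [ 1 ] ∷ [])
    × Run t (ξ ∙ 1 ∙ 1) (strip (neg (ξ ∙ 1) [ 1 ]) (strip (pos ξ (0 ∷ 1 ∷ [])) P))
  tail-runs ξ P path ab fr runs p t with runs (inTail t)
  ... | N , hN , rest , cb , cv with D₀-move ab fr cb cv
  ...   | inj₁ d = ⊥-elim (incoherent-✠-pos (above-coherent {P} ab _ _ d p))
  ...   | inj₂ (I , _ , n , cv' , _) with hN _ n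
  ...     | refl , _
            with tester-answer ξ (0 ∷ 1 ∷ []) 1 {P} cb (λ q → no✠ (hN _ q)) (λ _ _ q → next (hN _ q)) cv'
    where
      no✠ : ¬ ListTester (inTail t) ξ (neg ξ (0 ∷ 1 ∷ []) ∷ [ daimon ])
      no✠ (_ , () , _)
      next : ∀ {σ I} → ListTester (inTail t) ξ (neg ξ (0 ∷ 1 ∷ []) ∷ [ pos σ I ]) → σ ≡ ξ ∙ 1 × I ≡ [ 1 ]
      next (_ , refl , _) = refl , refl
  ...       | n₂ , rest' , cb' , cv'' , _ = n₂ , _ , (λ c q → proj₂ (proj₂ (hN _ q))) , rest' , cb' , cv''

  somePosition : ∀ n → Position n
  somePosition zero    = atNil
  somePosition (suc n) = atHead

  extract-list : ∀ {n} ξ P path → Above P path → Fresh path ξ → (∀ (t : Position n) → Run t ξ P) →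
    Σ (PList n) λ s → PartialListD s ξ ⊆ P
  extract-list {zero} ξ P path ab fr runs with runs atNil
  ... | N , hN , rest , cb , cv with D₀-move ab fr cb cv
  ...   | inj₁ d = stopL , ⊆-singleton {ListChr stopL ξ} (λ _ _ q → q) d
  ...   | inj₂ (I , p , n , _) with hN _ n
  ...     | refl , _ = nilL , ⊆-singleton {ListChr nilL ξ} (λ _ _ q → q) p
  extract-list {suc m} ξ P path ab fr runs with runs atHead
  ... | N , hN , rest , cb , cv with D₀-move ab fr cb cv
  ...   | inj₁ d = stopL , ⊆-singleton {ListChr stopL ξ} (λ _ _ q → q) d
  ...   | inj₂ (I , p , n , cv' , _) with hN _ n
  ...     | refl , _
            with tester-answer ξ (0 ∷ 1 ∷ []) 0 {P} cb (λ q → no✠ (hN _ q)) (λ _ _ q → next (hN _ q)) cv'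
    where
      no✠ : ¬ ListTester (atHead {m}) ξ (neg ξ (0 ∷ 1 ∷ []) ∷ [ daimon ])
      no✠ (_ , () , _)
      next : ∀ {σ I} → ListTester (atHead {m}) ξ (neg ξ (0 ∷ 1 ∷ []) ∷ [ pos σ I ]) → σ ≡ ξ ∙ 0 × I ≡ [ 1 ]
      next (_ , refl , _) = refl , refl
  ...       | n₂ , rest' , cb' , cv'' , _
              with extract-nat (suc (depth cv'')) (ξ ∙ 0 ∙ 1) _ _ _ (path ++ pos ξ (0 ∷ 1 ∷ []) ∷ neg (ξ ∙ 0) [ 1 ] ∷ [])
                     (λ c q → proj₂ (proj₂ (hN _ q))) cb' (above-extend {P} ab) (fresh-extend fr) cv'' ≤-refl
  ...         | h , h⊆
                with extract-list (ξ ∙ 1 ∙ 1) _ (path ++ pos ξ (0 ∷ 1 ∷ []) ∷ neg (ξ ∙ 1) [ 1 ] ∷ [])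
                       (above-extend {P} ab) (fresh-extend fr) (λ t → proj₂ (tail-runs ξ P path ab fr runs p t))
  ...           | s , s⊆ =
    consL h s , consL-⊆ ξ h s p n₂ (proj₁ (tail-runs ξ P path ab fr runs p (somePosition m))) h⊆ s⊆

-- Every design of 𝕃ₙ^⊥⊥ contains a partial list: run it against all testers.
extract : ∀ {n} ξ D → Biorth ξ (L ξ n) D → Σ (PList n) λ s → PartialListD s ξ ⊆ D
extract ξ D (des , orth) = Extraction.extract-list ξ D des ξ D [] (λ c p → p) fresh₀
    (λ t → Tester t ξ , (λ c → proj₂) , [] , [] , orth (Tester t ξ) (tester-perp t ξ))
  where
    fresh₀ : Extraction.Fresh ξ D des [] ξ
    fresh₀ σ I (inj₁ (here e))    = inj₂ e
    fresh₀ σ I (inj₂ (b , () , _))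

-- Partial lists lie in 𝕃ₙ^⊥⊥: 𝔇ˢ is a ✠-shortening of the list listValue s.

ShortenedIn : ChrSet → List Action → Set
ShortenedIn X c = X c ⊎ (Σ (List Action) λ c₁ → Σ (List Action) λ c₂ → c ≡ c₁ ++ c₂
  × (c₁ ≡ [] ⊎ (EndsNegative c₁ × X c₁)) × X (c₁ ++ [ daimon ]))

shortenedIn-∷₂ : ∀ {X Y : ChrSet} {x y c} → Negative y → X [] → (∀ d → X d → Y (x ∷ y ∷ d)) →
  ShortenedIn X c → ShortenedIn Y (x ∷ y ∷ c)
shortenedIn-∷₂ ny x[] f (inj₁ q) = inj₁ (f _ q)
shortenedIn-∷₂ {X} ny x[] f (inj₂ (c₁ , c₂ , refl , pre , d)) =
  inj₂ (_ ∷ _ ∷ c₁ , c₂ , refl , inj₂ (emptyOrEndsNeg-∷₂ ny (forget pre) , f _ (prefix pre)) , f _ d)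
  where
    forget : c₁ ≡ [] ⊎ (EndsNegative c₁ × X c₁) → EmptyOrEndsNeg c₁
    forget (inj₁ e)        = inj₁ e
    forget (inj₂ (en , _)) = inj₂ en
    prefix : c₁ ≡ [] ⊎ (EndsNegative c₁ × X c₁) → X c₁
    prefix (inj₁ refl)    = x[]
    prefix (inj₂ (_ , q)) = q

natChr-shortened : ∀ h τ c → NatChr (nat (natValue h)) τ c → ShortenedIn (NatChr h τ) c
natChr-shortened h        τ []          p                 = inj₁ tt
natChr-shortened stopN    τ (x ∷ r)     p                 = inj₂ ([] , _ , refl , inj₁ refl , refl , refl)
natChr-shortened zeroN    τ (x ∷ r)     p                 = inj₁ p
natChr-shortened (sucN h) τ (x ∷ [])    (e , _)           = inj₁ (e , tt)
natChr-shortened (sucN h) τ (x ∷ y ∷ r) (refl , refl , q) =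
  shortenedIn-∷₂ tt tt (λ d q' → refl , refl , q') (natChr-shortened h _ r q)

listChr-shortened : ∀ {n} (s : PList n) ξ c → ListChr (list (listValue s)) ξ c → ShortenedIn (ListChr s ξ) c
listChr-shortened s           ξ []          p = inj₁ tt
listChr-shortened stopL       ξ (x ∷ r)     p = inj₂ ([] , _ , refl , inj₁ refl , refl , refl)
listChr-shortened nilL        ξ (x ∷ r)     p = inj₁ p
listChr-shortened (consL h t) ξ (x ∷ [])    (e , _) = inj₁ (e , tt)
listChr-shortened (consL h t) ξ (x ∷ y ∷ r) (refl , inj₁ (refl , q)) =
  shortenedIn-∷₂ tt tt (λ d q' → refl , inj₁ (refl , q')) (natChr-shortened h _ r q)
listChr-shortened (consL h t) ξ (x ∷ y ∷ r) (refl , inj₂ (refl , q)) =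
  shortenedIn-∷₂ tt tt (λ d q' → refl , inj₂ (refl , q')) (listChr-shortened t _ r q)

partialListD-shortens : ∀ {n} (s : PList n) ξ → ShortensPos (PartialListD s ξ) (ListD (toList (listValue s)) ξ)
partialListD-shortens s ξ c p with listChr-shortened s ξ c (listD-listChr (listValue s) ξ c p)
... | inj₁ q = inj₁ (listD-nonempty (toList (listValue s)) ξ c p , q)
... | inj₂ (c₁ , c₂ , eq , inj₁ e , d) = inj₂ (c₁ , c₂ , eq , inj₁ e , snoc≢[] c₁ daimon , d)
... | inj₂ (c₁ , c₂ , eq , inj₂ (en , q) , d) =
  inj₂ (c₁ , c₂ , eq , inj₂ (en , (λ e → endsNeg-[] (subst EndsNegative e en)) , q) , snoc≢[] c₁ daimon , d)

listValue-∈𝕃 : ∀ {n} (s : PList n) ξ → L ξ n (ListD (toList (listValue s)) ξ)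
listValue-∈𝕃 s ξ = lift (listValue s , (λ c p → p) , (λ c p → p))

partialListD-biorth : ∀ {n} ξ (s : PList n) D → IsDesign nothing [ ξ ] D → PartialListD s ξ ⊆ D →
  Biorth ξ (L ξ n) (PartialListD s ξ)
partialListD-biorth ξ s D des sub =
  shortens-biorth (listValue-∈𝕃 s ξ) (partialListD-shortens s ξ) (partialListD-design ξ s D des sub)

cutOf : ∀ {X c} → ShortenedIn X c → List Action
cutOf {c = c} (inj₁ _)                      = c
cutOf (inj₂ (c₁ , _ , _ , _ , _))           = c₁ ++ [ daimon ]

cutOf-shorten : ∀ {X c} (r : ShortenedIn X c) → DaimonShorten c (cutOf r)
cutOf-shorten (inj₁ _)                                   = inj₁ refl
cutOf-shorten (inj₂ (c₁ , c₂ , eq , inj₁ e , _))         = inj₂ (c₁ , c₂ , eq , inj₁ e , refl)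
cutOf-shorten (inj₂ (c₁ , c₂ , eq , inj₂ (en , _) , _))  = inj₂ (c₁ , c₂ , eq , inj₂ en , refl)

cutOf-in : ∀ {X c} (r : ShortenedIn X c) → X (cutOf r)
cutOf-in (inj₁ q)                   = q
cutOf-in (inj₂ (_ , _ , _ , _ , d)) = d

cutOf-∷₂ : ∀ {X Y : ChrSet} {x y c} (ny : Negative y) (x[] : X []) (f : ∀ d → X d → Y (x ∷ y ∷ d))
  (r : ShortenedIn X c) → cutOf (shortenedIn-∷₂ {X} {Y} ny x[] f r) ≡ x ∷ y ∷ cutOf r
cutOf-∷₂ ny x[] f (inj₁ _) = refl
cutOf-∷₂ ny x[] f (inj₂ (_ , _ , refl , _ , _)) = refl

-- Chronicles of a list carry a unique proof of their shape: the two branches of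
-- a cons are on the distinct addresses ξ.0 and ξ.1.
∙-injective : ∀ ξ {i j} → ξ ∙ i ≡ ξ ∙ j → i ≡ j
∙-injective []      e = ∷-injectiveˡ e
∙-injective (x ∷ ξ) e = ∙-injective ξ (∷-injectiveʳ e)

neg-address : ∀ {σ σ' I I'} → neg σ I ≡ neg σ' I' → σ ≡ σ'
neg-address refl = refl

natChr-irrelevant : ∀ a τ c (q q' : NatChr (nat a) τ c) → q ≡ q'
natChr-irrelevant a       τ []          tt                tt                 = refl
natChr-irrelevant zero    τ (x ∷ r)     (refl , refl)     (refl , refl)      = refl
natChr-irrelevant (suc a) τ (x ∷ [])    (refl , tt)       (refl , tt)        = refl
natChr-irrelevant (suc a) τ (x ∷ y ∷ r) (refl , refl , q) (refl , refl , q') =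
  cong (λ z → refl , refl , z) (natChr-irrelevant a _ r q q')

listChr-irrelevant : ∀ {n} (v : Vec ℕ n) ξ c (q q' : ListChr (list v) ξ c) → q ≡ q'
listChr-irrelevant v        ξ []          tt            tt            = refl
listChr-irrelevant []ᵥ      ξ (x ∷ r)     (refl , refl) (refl , refl) = refl
listChr-irrelevant (a ∷ᵥ v) ξ (x ∷ [])    (refl , tt)   (refl , tt)   = refl
listChr-irrelevant (a ∷ᵥ v) ξ (x ∷ y ∷ r) (refl , inj₁ (refl , q)) (refl , inj₁ (refl , q')) =
  cong (λ z → refl , inj₁ (refl , z)) (natChr-irrelevant a _ r q q')
listChr-irrelevant (a ∷ᵥ v) ξ (x ∷ y ∷ r) (refl , inj₂ (refl , q)) (refl , inj₂ (refl , q')) =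
  cong (λ z → refl , inj₂ (refl , z)) (listChr-irrelevant v _ r q q')
listChr-irrelevant (a ∷ᵥ v) ξ (x ∷ y ∷ r) (refl , inj₁ (refl , q)) (refl , inj₂ (e , q'))
  with ∙-injective ξ (neg-address e)
... | ()
listChr-irrelevant (a ∷ᵥ v) ξ (x ∷ y ∷ r) (refl , inj₂ (refl , q)) (refl , inj₁ (e , q'))
  with ∙-injective ξ (neg-address e)
... | ()

shortenTo : ∀ {n} (s : PList n) ξ c → ListChr (list (listValue s)) ξ c → List Action
shortenTo s ξ c q = cutOf (listChr-shortened s ξ c q)

natChr-uncut : ∀ h τ d → NatChr h τ d →
  Σ (List Action) λ c → Σ (NatChr (nat (natValue h)) τ c) λ q → d ≼ cutOf (natChr-shortened h τ c q)
natChr-uncut stopN    τ []          p                 = [] , tt , [] , refl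
natChr-uncut stopN    τ (x ∷ r)     (refl , refl)     = [ pos τ [] ] , (refl , refl) , [] , refl
natChr-uncut zeroN    τ []          p                 = [] , tt , [] , refl
natChr-uncut zeroN    τ (x ∷ r)     p                 = x ∷ r , p , [] , ++-identityʳ _
natChr-uncut (sucN h) τ []          p                 = [] , tt , [] , refl
natChr-uncut (sucN h) τ (x ∷ [])    (e , _)           = [ x ] , (e , tt) , [] , refl
natChr-uncut (sucN h) τ (x ∷ y ∷ r) (refl , refl , p) with natChr-uncut h _ r p
... | c , q , w , eq = x ∷ y ∷ c , (refl , refl , q) , w ,
  trans (cong (λ z → x ∷ y ∷ z) eq)
        (sym (cutOf-∷₂ {NatChr h _} tt tt (λ d q' → refl , refl , q') (natChr-shortened h _ c q)))

stopL-≼✠ : ∀ {n} ξ d → ListChr (stopL {n}) ξ d → d ≼ [ daimon ]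
stopL-≼✠ ξ []      _             = [ daimon ] , refl
stopL-≼✠ ξ (x ∷ r) (refl , refl) = [] , refl

listChr-uncut : ∀ {n} (s : PList n) ξ d → ListChr s ξ d →
  Σ (List Action) λ c → Σ (ListChr (list (listValue s)) ξ c) λ q → c ≢ [] × d ≼ shortenTo s ξ c q
listChr-uncut {zero}  stopL ξ d p = [ pos ξ [] ] , (refl , refl) , (λ ()) , stopL-≼✠ ξ d p
listChr-uncut {suc m} stopL ξ d p = [ pos ξ (0 ∷ 1 ∷ []) ] , (refl , tt) , (λ ()) , stopL-≼✠ ξ d p
listChr-uncut nilL        ξ []      p       = [ pos ξ [] ] , (refl , refl) , (λ ()) , _ , refl
listChr-uncut nilL        ξ (x ∷ r) p       = x ∷ r , p , (λ ()) , [] , ++-identityʳ _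
listChr-uncut (consL h t) ξ []      p       = [ pos ξ (0 ∷ 1 ∷ []) ] , (refl , tt) , (λ ()) , _ , refl
listChr-uncut (consL h t) ξ (x ∷ []) (e , _) = [ x ] , (e , tt) , (λ ()) , [] , refl
listChr-uncut (consL h t) ξ (x ∷ y ∷ r) (refl , inj₁ (refl , p)) with natChr-uncut h _ r p
... | c , q , w , eq = x ∷ y ∷ c , (refl , inj₁ (refl , q)) , (λ ()) , w ,
  trans (cong (λ z → x ∷ y ∷ z) eq)
        (sym (cutOf-∷₂ {NatChr h _} tt tt (λ d q' → refl , inj₁ (refl , q')) (natChr-shortened h _ c q)))
listChr-uncut (consL h t) ξ (x ∷ y ∷ r) (refl , inj₂ (refl , p)) with listChr-uncut t _ r p
... | c , q , _ , w , eq = x ∷ y ∷ c , (refl , inj₂ (refl , q)) , (λ ()) , w ,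
  trans (cong (λ z → x ∷ y ∷ z) eq)
        (sym (cutOf-∷₂ {ListChr t _} tt tt (λ d q' → refl , inj₂ (refl , q')) (listChr-shortened t _ c q)))

partialList-∈𝕃✠ : ∀ {n} ξ (s : PList n) D → IsDesign nothing [ ξ ] D → D ≐ PartialListD s ξ →
  DaimonShortenings ξ (L ξ n) D
partialList-∈𝕃✠ {n} ξ s D des (D⊆s , s⊆D) =
  des , ListD as ξ , listValue-∈𝕃 s ξ , f , (λ c p → cutOf-shorten (listChr-shortened s ξ c _)) , D⊆image , image⊆D
  where
    as = toList (listValue s)
    f : (c : List Action) → ListD as ξ c → List Action
    f c p = shortenTo s ξ c (listD-listChr (listValue s) ξ c p)
    Image : ChrSet
    Image = PrefixClosure (λ d → Σ (List Action) λ c → Σ (ListD as ξ c) λ p → d ≡ f c p)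
    D⊆image : D ⊆ Image
    D⊆image d dd with D⊆s d dd
    ... | ne , q with listChr-uncut s ξ d q
    ...   | c , qc , nec , w , eq =
      ne , f c p , (c , p , refl) , w ,
      trans eq (cong (shortenTo s ξ c) (listChr-irrelevant (listValue s) ξ c qc _))
      where p = listChr-listD (listValue s) ξ c nec qc
    image⊆D : Image ⊆ D
    image⊆D d (ne , _ , (c , p , refl) , w , eq) =
      s⊆D d (ne , listChr-prefix s ξ d w (subst (ListChr s ξ) (sym eq) (cutOf-in (listChr-shortened s ξ c _))))

-- Conversely, a partial list inside a ✠-shortening of a list absorbs it.  The
-- chronicles of ✠-shortenings of nat a (list v) are those following its spine
-- in which ✠ may replace any positive action.

mutual
  CutNatChr : ℕ → Address → List Action → Set
  CutNatChr a τ []      = ⊤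
  CutNatChr a τ (x ∷ r) = (x ≡ daimon × r ≡ []) ⊎ CutNatChr₁ a τ x r

  CutNatChr₁ : ℕ → Address → Action → List Action → Set
  CutNatChr₁ zero    τ x r = x ≡ pos τ [] × r ≡ []
  CutNatChr₁ (suc a) τ x r = x ≡ pos τ [ 0 ] × CutNatChr′ a τ r

  CutNatChr′ : ℕ → Address → List Action → Set
  CutNatChr′ a τ []      = ⊤
  CutNatChr′ a τ (y ∷ r) = y ≡ neg (τ ∙ 0) [ 1 ] × CutNatChr a (τ ∙ 0 ∙ 1) r

mutual
  CutListChr : ∀ {n} → Vec ℕ n → Address → List Action → Set
  CutListChr v ξ []      = ⊤
  CutListChr v ξ (x ∷ r) = (x ≡ daimon × r ≡ []) ⊎ CutListChr₁ v ξ x r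

  CutListChr₁ : ∀ {n} → Vec ℕ n → Address → Action → List Action → Set
  CutListChr₁ []ᵥ      ξ x r = x ≡ pos ξ [] × r ≡ []
  CutListChr₁ (a ∷ᵥ v) ξ x r = x ≡ pos ξ (0 ∷ 1 ∷ []) × CutListChr′ a v ξ r

  CutListChr′ : ∀ {n} → ℕ → Vec ℕ n → Address → List Action → Set
  CutListChr′ a v ξ []      = ⊤
  CutListChr′ a v ξ (y ∷ r) =
    (y ≡ neg (ξ ∙ 0) [ 1 ] × CutNatChr a (ξ ∙ 0 ∙ 1) r)
    ⊎ (y ≡ neg (ξ ∙ 1) [ 1 ] × CutListChr v (ξ ∙ 1 ∙ 1) r)

cutNatChr-prefix : ∀ a τ c d → CutNatChr a τ (c ++ d) → CutNatChr a τ c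
cutNatChr-prefix a       τ []          d p                       = tt
cutNatChr-prefix a       τ (x ∷ c)     d (inj₁ (e , q))          = inj₁ (e , ++-conicalˡ c d q)
cutNatChr-prefix zero    τ (x ∷ c)     d (inj₂ (e , q))          = inj₂ (e , ++-conicalˡ c d q)
cutNatChr-prefix (suc a) τ (x ∷ [])    d (inj₂ (e , q))          = inj₂ (e , tt)
cutNatChr-prefix (suc a) τ (x ∷ y ∷ c) d (inj₂ (e , e' , q))     = inj₂ (e , e' , cutNatChr-prefix a _ c d q)

cutListChr-prefix : ∀ {n} (v : Vec ℕ n) ξ c d → CutListChr v ξ (c ++ d) → CutListChr v ξ c
cutListChr-prefix v        ξ []          d p                  = tt
cutListChr-prefix v        ξ (x ∷ c)     d (inj₁ (e , q))     = inj₁ (e , ++-conicalˡ c d q)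
cutListChr-prefix []ᵥ      ξ (x ∷ c)     d (inj₂ (e , q))     = inj₂ (e , ++-conicalˡ c d q)
cutListChr-prefix (a ∷ᵥ v) ξ (x ∷ [])    d (inj₂ (e , q))     = inj₂ (e , tt)
cutListChr-prefix (a ∷ᵥ v) ξ (x ∷ y ∷ c) d (inj₂ (e , inj₁ (e' , q))) =
  inj₂ (e , inj₁ (e' , cutNatChr-prefix a _ c d q))
cutListChr-prefix (a ∷ᵥ v) ξ (x ∷ y ∷ c) d (inj₂ (e , inj₂ (e' , q))) =
  inj₂ (e , inj₂ (e' , cutListChr-prefix v _ c d q))

natChr-cut : ∀ a τ c → NatChr (nat a) τ c → CutNatChr a τ c
natChr-cut a       τ []          p            = tt
natChr-cut zero    τ (x ∷ r)     p            = inj₂ p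
natChr-cut (suc a) τ (x ∷ [])    (e , _)      = inj₂ (e , tt)
natChr-cut (suc a) τ (x ∷ y ∷ r) (e , e' , q) = inj₂ (e , e' , natChr-cut a _ r q)

listChr-cut : ∀ {n} (v : Vec ℕ n) ξ c → ListChr (list v) ξ c → CutListChr v ξ c
listChr-cut v        ξ []          p                  = tt
listChr-cut []ᵥ      ξ (x ∷ r)     p                  = inj₂ p
listChr-cut (a ∷ᵥ v) ξ (x ∷ [])    (e , _)            = inj₂ (e , tt)
listChr-cut (a ∷ᵥ v) ξ (x ∷ y ∷ r) (e , inj₁ (e' , q)) = inj₂ (e , inj₁ (e' , natChr-cut a _ r q))
listChr-cut (a ∷ᵥ v) ξ (x ∷ y ∷ r) (e , inj₂ (e' , q)) = inj₂ (e , inj₂ (e' , listChr-cut v _ r q))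

natChr-cut✠ : ∀ a τ c → NatChr (nat a) τ c → EmptyOrEndsNeg c → CutNatChr a τ (c ++ [ daimon ])
natChr-cut✠ a       τ []          p                 pre = inj₁ (refl , refl)
natChr-cut✠ zero    τ (x ∷ r)     (refl , refl)     pre = ⊥-elim (emptyOrEndsNeg-pos pre)
natChr-cut✠ (suc a) τ (x ∷ [])    (refl , _)        pre = ⊥-elim (emptyOrEndsNeg-pos pre)
natChr-cut✠ (suc a) τ (x ∷ y ∷ r) (refl , refl , q) pre =
  inj₂ (refl , refl , natChr-cut✠ a _ r q (emptyOrEndsNeg-drop₂ pre))

listChr-cut✠ : ∀ {n} (v : Vec ℕ n) ξ c → ListChr (list v) ξ c → EmptyOrEndsNeg c → CutListChr v ξ (c ++ [ daimon ])
listChr-cut✠ v        ξ []          p             pre = inj₁ (refl , refl)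
listChr-cut✠ []ᵥ      ξ (x ∷ r)     (refl , refl) pre = ⊥-elim (emptyOrEndsNeg-pos pre)
listChr-cut✠ (a ∷ᵥ v) ξ (x ∷ [])    (refl , _)    pre = ⊥-elim (emptyOrEndsNeg-pos pre)
listChr-cut✠ (a ∷ᵥ v) ξ (x ∷ y ∷ r) (refl , inj₁ (refl , q)) pre =
  inj₂ (refl , inj₁ (refl , natChr-cut✠ a _ r q (emptyOrEndsNeg-drop₂ pre)))
listChr-cut✠ (a ∷ᵥ v) ξ (x ∷ y ∷ r) (refl , inj₂ (refl , q)) pre =
  inj₂ (refl , inj₂ (refl , listChr-cut✠ v _ r q (emptyOrEndsNeg-drop₂ pre)))

daimonShorten-cut : ∀ {n} (v : Vec ℕ n) ξ c d → ListChr (list v) ξ c → DaimonShorten c d → CutListChr v ξ d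
daimonShorten-cut v ξ c .c p (inj₁ refl) = listChr-cut v ξ c p
daimonShorten-cut v ξ .(c₁ ++ c₂) .(c₁ ++ [ daimon ]) p (inj₂ (c₁ , c₂ , refl , pre , refl)) =
  listChr-cut✠ v ξ c₁ (listChr-prefix (list v) ξ c₁ c₂ p) pre

-- In a coherent X containing the partial natural h, every nonempty chronicle
-- of the shape of a cut natural is a chronicle of h: where h and the chronicle
-- first differ, X would contain two distinct positive actions (or ✠ and a
-- positive action) at the same point.
natChr-absorb : ∀ h a τ (X : ChrSet) → Coh X → NonEmpty (NatChr h τ) ⊆ X →
  ∀ c → X c → CutNatChr a τ c → c ≢ [] → NatChr h τ c
natChr-absorb h a τ X co sub [] xc cut ne = ⊥-elim (ne refl)
natChr-absorb stopN a τ X co sub (x ∷ r) xc (inj₁ (refl , refl)) ne = refl , refl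
natChr-absorb zeroN a τ X co sub (x ∷ r) xc (inj₁ (refl , refl)) ne =
  ⊥-elim (incoherent-✠-pos (co _ _ xc (sub [ pos τ [] ] ((λ ()) , refl , refl))))
natChr-absorb (sucN h) a τ X co sub (x ∷ r) xc (inj₁ (refl , refl)) ne =
  ⊥-elim (incoherent-✠-pos (co _ _ xc (sub [ pos τ [ 0 ] ] ((λ ()) , refl , tt))))
natChr-absorb stopN zero τ X co sub (x ∷ r) xc (inj₂ (refl , refl)) ne =
  ⊥-elim (incoherent-✠-pos (co _ _ (sub [ daimon ] ((λ ()) , refl , refl)) xc))
natChr-absorb stopN (suc a) τ X co sub (x ∷ r) xc (inj₂ (refl , _)) ne =
  ⊥-elim (incoherent-✠-pos (co _ _ (sub [ daimon ] ((λ ()) , refl , refl)) xc))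
natChr-absorb zeroN zero τ X co sub (x ∷ r) xc (inj₂ (refl , refl)) ne = refl , refl
natChr-absorb zeroN (suc a) τ X co sub (x ∷ r) xc (inj₂ (refl , _)) ne =
  ⊥-elim (incoherent-pos-pos (λ ()) (co _ _ xc (sub [ pos τ [] ] ((λ ()) , refl , refl))))
natChr-absorb (sucN h) zero τ X co sub (x ∷ r) xc (inj₂ (refl , refl)) ne =
  ⊥-elim (incoherent-pos-pos (λ ()) (co _ _ xc (sub [ pos τ [ 0 ] ] ((λ ()) , refl , tt))))
natChr-absorb (sucN h) (suc a) τ X co sub (x ∷ []) xc (inj₂ (refl , _)) ne = refl , tt
natChr-absorb (sucN h) (suc a) τ X co sub (x ∷ y ∷ []) xc (inj₂ (refl , refl , _)) ne = refl , refl , tt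
natChr-absorb (sucN h) (suc a) τ X co sub (x ∷ y ∷ z ∷ r) xc (inj₂ (refl , refl , cut)) ne =
  refl , refl , natChr-absorb h a _ _ (coh-strip _ (coh-strip _ co))
                  (λ c q → sub _ ((λ ()) , refl , refl , proj₂ q)) (z ∷ r) xc cut (λ ())

listChr-absorb : ∀ {n} (s : PList n) (v : Vec ℕ n) ξ (X : ChrSet) → Coh X → PartialListD s ξ ⊆ X →
  ∀ c → X c → CutListChr v ξ c → c ≢ [] → ListChr s ξ c
listChr-absorb s v ξ X co sub [] xc cut ne = ⊥-elim (ne refl)
listChr-absorb stopL v ξ X co sub (x ∷ r) xc (inj₁ (refl , refl)) ne = refl , refl
listChr-absorb nilL v ξ X co sub (x ∷ r) xc (inj₁ (refl , refl)) ne =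
  ⊥-elim (incoherent-✠-pos (co _ _ xc (sub [ pos ξ [] ] ((λ ()) , refl , refl))))
listChr-absorb (consL h t) v ξ X co sub (x ∷ r) xc (inj₁ (refl , refl)) ne =
  ⊥-elim (incoherent-✠-pos (co _ _ xc (sub [ pos ξ (0 ∷ 1 ∷ []) ] ((λ ()) , refl , tt))))
listChr-absorb stopL []ᵥ ξ X co sub (x ∷ r) xc (inj₂ (refl , refl)) ne =
  ⊥-elim (incoherent-✠-pos (co _ _ (sub [ daimon ] ((λ ()) , refl , refl)) xc))
listChr-absorb stopL (a ∷ᵥ v) ξ X co sub (x ∷ r) xc (inj₂ (refl , _)) ne =
  ⊥-elim (incoherent-✠-pos (co _ _ (sub [ daimon ] ((λ ()) , refl , refl)) xc))
listChr-absorb nilL []ᵥ ξ X co sub (x ∷ r) xc (inj₂ (refl , refl)) ne = refl , refl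
listChr-absorb (consL h t) (a ∷ᵥ v) ξ X co sub (x ∷ []) xc (inj₂ (refl , _)) ne = refl , tt
listChr-absorb (consL h t) (a ∷ᵥ v) ξ X co sub (x ∷ y ∷ []) xc (inj₂ (refl , inj₁ (refl , _))) ne =
  refl , inj₁ (refl , tt)
listChr-absorb (consL h t) (a ∷ᵥ v) ξ X co sub (x ∷ y ∷ []) xc (inj₂ (refl , inj₂ (refl , _))) ne =
  refl , inj₂ (refl , tt)
listChr-absorb (consL h t) (a ∷ᵥ v) ξ X co sub (x ∷ y ∷ z ∷ r) xc (inj₂ (refl , inj₁ (refl , cut))) ne =
  refl , inj₁ (refl , natChr-absorb h a _ _ (coh-strip _ (coh-strip _ co))
                        (λ c q → sub _ ((λ ()) , refl , inj₁ (refl , proj₂ q))) (z ∷ r) xc cut (λ ()))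
listChr-absorb (consL h t) (a ∷ᵥ v) ξ X co sub (x ∷ y ∷ z ∷ r) xc (inj₂ (refl , inj₂ (refl , cut))) ne =
  refl , inj₂ (refl , listChr-absorb t v _ _ (coh-strip _ (coh-strip _ co))
                        (λ c q → sub _ ((λ ()) , refl , inj₂ (refl , proj₂ q))) (z ∷ r) xc cut (λ ()))

shortening-∈biorth : ∀ {n} ξ D' → DaimonShortenings ξ (L ξ n) D' → Biorth ξ (L ξ n) D'
shortening-∈biorth {n} ξ D' (des' , D₀ , D₀∈𝕃@(lift (v , D₀⊆v , _)) , f , f-shortens , _ , image⊆D') =
  shortens-biorth D₀∈𝕃 shortens des'
  where
    image : ∀ {c} (p : D₀ c) d → d ≢ [] → d ≼ f c p → D' d
    image {c} p d ne w = image⊆D' d (ne , f c p , (c , p , refl) , w)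
    shortens : ShortensPos D' D₀
    shortens c p with f-shortens c p
    ... | inj₁ eq = inj₁ (image p c (listD-nonempty (toList v) ξ c (D₀⊆v c p)) ([] , trans (++-identityʳ c) (sym eq)))
    ... | inj₂ (c₁ , c₂ , eq , pre , eq✠) = inj₂ (c₁ , c₂ , eq , prefix pre ,
          image p _ (snoc≢[] c₁ daimon) ([] , trans (++-identityʳ _) (sym eq✠)))
      where
        prefix : EmptyOrEndsNeg c₁ → c₁ ≡ [] ⊎ (EndsNegative c₁ × D' c₁)
        prefix (inj₁ e)  = inj₁ e
        prefix (inj₂ en) = inj₂ (en , image p c₁ (λ e → endsNeg-[] (subst EndsNegative e en))
                                        ([ daimon ] , sym eq✠))

shortening-cut : ∀ {n} ξ D' → DaimonShortenings ξ (L ξ n) D' →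
  Σ (Vec ℕ n) λ v → ∀ c → D' c → CutListChr v ξ c
shortening-cut ξ D' (_ , D₀ , lift (v , D₀⊆v , _) , f , f-shortens , D'⊆image , _) = v , cut
  where
    cut : ∀ c → D' c → CutListChr v ξ c
    cut c dc with D'⊆image c dc
    ... | _ , _ , (c₀ , p₀ , refl) , w , eq =
      cutListChr-prefix v ξ c w (subst (CutListChr v ξ) (sym eq)
        (daimonShorten-cut v ξ c₀ (f c₀ p₀) (listD-listChr v ξ c₀ (D₀⊆v c₀ p₀)) (f-shortens c₀ p₀)))

-- Any D'' ⊆ D' in 𝕃ₙ^⊥⊥ contains a partial list, which absorbs all of D'.
cut-material : ∀ {n} ξ (v : Vec ℕ n) D' → IsDesign nothing [ ξ ] D' → (∀ c → D' c → CutListChr v ξ c) →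
  Material (Biorth ξ (L ξ n)) D'
cut-material ξ v D' des cut c dc D'' D''⊆D' D''∈ with extract ξ D'' D''∈
... | s , s⊆D'' = s⊆D'' c (ne , listChr-absorb s v ξ D' (IsDesign.coherent des)
                                  (λ c' q → D''⊆D' c' (s⊆D'' c' q)) c dc (cut c dc) ne)
  where ne = Chronicle.nonempty (IsDesign.chronicles des c dc)

-- A material design of 𝕃ₙ^⊥⊥ is the partial list it contains, hence in 𝕃ₙ^✠.
material-∈𝕃✠ : ∀ {n} ξ D → Incarnation (Biorth ξ (L ξ n)) D → DaimonShortenings ξ (L ξ n) D
material-∈𝕃✠ ξ D (D∈@(des , _) , material) with extract ξ D D∈
... | s , s⊆D = partialList-∈𝕃✠ ξ s D des (D⊆s , s⊆D)
  where
    D⊆s : D ⊆ PartialListD s ξ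
    D⊆s c dc = material c dc (PartialListD s ξ) s⊆D (partialListD-biorth ξ s D des s⊆D)

shortening-material : ∀ {n} ξ D → DaimonShortenings ξ (L ξ n) D → Incarnation (Biorth ξ (L ξ n)) D
shortening-material ξ D ds with shortening-cut ξ D ds
... | v , cut = shortening-∈biorth ξ D ds , cut-material ξ v D (proj₁ ds) cut

lists-✠-free : ∀ ξ n D → L ξ n D → DaimonFree D
lists-✠-free ξ n D (lift (v , D⊆v , _)) c dc = listChr-✠-free v ξ c (listD-listChr v ξ c (D⊆v c dc))

mainTheorem2 : (ξ : Address) (n : ℕ) → Principal ξ (L ξ n)
mainTheorem2 ξ n = lists-✠-free ξ n , λ D → material-∈𝕃✠ ξ D , shortening-material ξ D
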